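{- Let $q>2$ be a prime power, $n\ge1$ with $\gcd(n,q)=1$, $A_n=GF(q)[x]/(x^n-1)$. Let $J\subseteq A_n$ be the minimal ideal with parity-check polynomial $h(x)$, where $h$ is irreducible over $GF(q)$ of degree $m>1$ and order $n$ with $n\neq q^m-1$. Put $R=(q^m-1)/(q-1)$, $d=\gcd(q-1,n)$ and $r=n/d$. Then every cycle of a nonzero element of $J$ meets exactly $r$ proportionality classes, each of these classes contains exactly $d$ distinct vectors of the cycle, $1\le d\le q-1$, $1\le r\le R$, and $r\mid R$.
   Context: $J$ is the ideal generated by $(x^n-1)/h(x)$, i.e. $J=\{z\in A_n: h(x)z(x)=0\}$. The order of $h$ is the least $e\ge1$ with $h\mid x^e-1$. For nonzero $z\in A_n$: the cycle of $z$ is $\{x^jz:j\ge0\}$ in $A_n$; the proportionality class of $z$ is $\{\alpha z:\alpha\in GF(q)^*\}$. -}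

module Defs where

open import Level using (0ℓ)
open import Data.Nat as ℕ using (ℕ; zero; suc; _<_; _≤_; _^_)
open import Data.Nat.DivMod using (_/_)
open import Data.Nat.Primality using (Prime)
open import Data.Fin using (Fin)
open import Data.List as L using (List; []; _∷_)
open import Data.Vec as V using (Vec; []; _∷_)
open import Data.Product using (Σ; ∃; _×_; _,_)
open import Data.Sum using (_⊎_)
open import Relation.Binary.PropositionalEquality using (_≡_; _≢_)
open import Relation.Nullary using (¬_)
open import Algebra.Structures using (IsCommutativeRing)
open import Function.Bundles using (_↔_)

-- Natural-number division with a harmless convention for divisor 0.
_div_ : ℕ → ℕ → ℕ
a div zero = 0
a div suc b = a / suc b

IsPrimePower : ℕ → Set
IsPrimePower q = Σ ℕ λ p → Σ ℕ λ k → Prime p × 1 ≤ k × q ≡ p ^ k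

record FiniteField (q : ℕ) : Set₁ where
  field
    Carrier : Set
    _+_ _*_ : Carrier → Carrier → Carrier
    -_      : Carrier → Carrier
    0# 1#   : Carrier
    isCommutativeRing : IsCommutativeRing _≡_ _+_ _*_ -_ 0# 1#
    0≢1     : 0# ≢ 1#
    inverse : ∀ a → a ≢ 0# → ∃ λ b → a * b ≡ 1#
    card    : Carrier ↔ Fin q

module _ {q : ℕ} (F : FiniteField q) where
  open FiniteField F

  -- Polynomials over F as coefficient lists (lowest degree first).
  Poly : Set
  Poly = List Carrier

  coeff : Poly → ℕ → Carrier
  coeff []       k       = 0#
  coeff (a ∷ p)  zero    = a
  coeff (a ∷ p)  (suc k) = coeff p k

  addP : Poly → Poly → Poly
  addP []      g       = g
  addP (a ∷ f) []      = a ∷ f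
  addP (a ∷ f) (b ∷ g) = (a + b) ∷ addP f g

  mulP : Poly → Poly → Poly
  mulP []      g = []
  mulP (a ∷ f) g = addP (L.map (a *_) g) (0# ∷ mulP f g)

  _≈P_ : Poly → Poly → Set
  f ≈P g = ∀ k → coeff f k ≡ coeff g k

  Deg : Poly → ℕ → Set
  Deg p m = coeff p m ≢ 0# × (∀ k → m < k → coeff p k ≡ 0#)

  -- irreducible over F: nonconstant, and any factorisation has a unit
  -- (nonzero constant, i.e. degree 0) factor
  Irreducible : Poly → Set
  Irreducible h = (Σ ℕ λ m → 1 ≤ m × Deg h m)
                × (∀ f g → h ≈P mulP f g → Deg f 0 ⊎ Deg g 0)

  _∣P_ : Poly → Poly → Set
  h ∣P p = Σ Poly λ g → mulP h g ≈P p

  xPowMinusOne : ℕ → Poly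
  xPowMinusOne e = addP (L.replicate e 0# L.++ (1# ∷ [])) ((- 1#) ∷ [])

  HasOrder : Poly → ℕ → Set
  HasOrder h n = 1 ≤ n × h ∣P xPowMinusOne n
               × (∀ e → 1 ≤ e → e < n → ¬ (h ∣P xPowMinusOne e))

  -- A_n = F[x]/(x^n - 1), elements as coefficient vectors (a_0,…,a_{n-1}).
  zeroA : ∀ {n} → Vec Carrier n
  zeroA {n} = V.replicate n 0#

  addA : ∀ {n} → Vec Carrier n → Vec Carrier n → Vec Carrier n
  addA = V.zipWith _+_

  scaleA : ∀ {n} → Carrier → Vec Carrier n → Vec Carrier n
  scaleA α = V.map (α *_)

  mulX : ∀ {n} → Vec Carrier n → Vec Carrier n
  mulX {zero}  v = v
  mulX {suc n} v = V.last v ∷ V.init v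

  mulXPow : ∀ {n} → ℕ → Vec Carrier n → Vec Carrier n
  mulXPow zero    v = v
  mulXPow (suc j) v = mulX (mulXPow j v)

  polyMulA : ∀ {n} → Poly → Vec Carrier n → Vec Carrier n
  polyMulA []      z = zeroA
  polyMulA (c ∷ p) z = addA (scaleA c z) (polyMulA p (mulX z))

  InJ : ∀ {n} → Poly → Vec Carrier n → Set
  InJ h z = polyMulA h z ≡ zeroA

  Proportional : ∀ {n} → Vec Carrier n → Vec Carrier n → Set
  Proportional u v = Σ Carrier λ α → α ≢ 0# × u ≡ scaleA α v

  CycleMeetsClasses : ∀ {n} → Vec Carrier n → ℕ → Set
  CycleMeetsClasses z r =
    Σ (Fin r → ℕ) λ c →
      (∀ i i' → Proportional (mulXPow (c i) z) (mulXPow (c i') z) → i ≡ i')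
    × (∀ j → ∃ λ i → Proportional (mulXPow j z) (mulXPow (c i) z))

  ClassMeetsCycleIn : ∀ {n} → Vec Carrier n → ℕ → ℕ → Set
  ClassMeetsCycleIn z j d =
    Σ (Fin d → ℕ) λ f →
      (∀ i i' → mulXPow (f i) z ≡ mulXPow (f i') z → i ≡ i')
    × (∀ i → Proportional (mulXPow (f i) z) (mulXPow j z))
    × (∀ k → Proportional (mulXPow k z) (mulXPow j z) →
         ∃ λ i → mulXPow k z ≡ mulXPow (f i) z)

{-# OPTIONS --safe #-}
-- Every nonzero z ∈ J has annihilator exactly (h), so x^e z = z iff n ∣ e.  If x^δ z = α z with α ∈ F*,
-- then α^(q-1) = 1 gives x^((q-1)δ) z = z, hence n ∣ (q-1)δ and t = n/d divides δ.  Conversely x^t z is a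
-- multiple of z: on z the map x^t is killed by X^(q-1) - 1 = ∏ (X - β) over β ∈ F*, so some partial product
-- yields an eigenvector of x^t in J, and its eigenvalue transfers to z.  Thus the cycle of z falls into the t
-- classes of z, x z, …, x^(t-1) z, each containing d of its vectors.  Finally x has order n in the unit group
-- of the field F[x]/(h), which has q^m - 1 elements, so n ∣ q^m - 1 and t divides R = (q^m - 1)/(q - 1).
module Submission where

open import Defs
open import Level using (0ℓ)
open import Data.Nat using (ℕ; zero; suc; _<_; _≤_; _∸_; z≤n; s≤s; NonZero)
import Data.Nat as ℕ
import Data.Nat.Properties as ℕₚ
open import Data.Fin as Fin using (Fin; toℕ; fromℕ<; punchIn; punchOut)
import Data.Fin.Properties as Finₚ
open import Data.Fin.Permutation using (Permutation′; permutation; _⟨$⟩ʳ_)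
open import Data.Vec as Vec using (Vec; []; _∷_; _∷ʳ_)
open import Data.List as List using (List; []; _∷_)
import Data.List.Properties as List
import Data.Vec.Properties as Vecₚ
open import Data.Nat.DivMod using (_/_; _%_; m≡m%n+[m/n]*n; m%n<n; m/n*n≡m; m≥n⇒m/n>0)
open import Data.Nat.Divisibility using (_∣_; divides; m%n≡0⇒n∣m; ∣⇒≤; >⇒∤; *-cancelʳ-∣)
open import Data.Nat.GCD using (gcd; gcd[m,n]∣m; gcd[m,n]∣n; gcd[m,n]≢0)
open import Data.Nat.Coprimality as Coprimality using (Coprime; coprime-/gcd; coprime-divisor)
open import Data.Nat.Tactic.RingSolver using (solve-∀)
open import Data.Product using (Σ; ∃; _×_; _,_; proj₁; proj₂)
open import Data.Empty using (⊥-elim)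
open import Data.List.Relation.Unary.All using (All; []; _∷_)
open import Data.List.Relation.Unary.AllPairs using (AllPairs; []; _∷_)
import Data.List.Relation.Unary.All.Properties as All
import Data.List.Relation.Unary.Unique.Propositional.Properties as Unique
open import Data.Sum using (_⊎_; inj₁; inj₂)
open import Relation.Nullary using (¬_; yes; no)
open import Relation.Binary.PropositionalEquality
  using (isEquivalence; _≡_; _≢_; refl; sym; trans; cong; cong₂; subst; subst₂; module ≡-Reasoning)
open import Function.Base using (_∘_)
open import Data.Nat.GeneralisedArithmetic using (iterate)
open import Function.Bundles using (_↔_; Inverse; mk↔ₛ′)
open import Algebra.Structures using (IsCommutativeRing)
open import Algebra.Bundles using (CommutativeMonoid; CommutativeRing; Semiring)
open import Data.Maybe using (nothing)
open import Relation.Binary.Definitions using (DecidableEquality)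
import Relation.Nullary.Decidable as Dec
import Tactic.RingSolver.Core.AlmostCommutativeRing as ACR
import Tactic.RingSolver.NonReflective
import Algebra.Solver.CommutativeMonoid
import Relation.Binary.Reasoning.Setoid

module ScaledSum {c ℓ} (M : CommutativeMonoid c ℓ) where
  open CommutativeMonoid M using (Carrier; _≈_; _∙_; ∙-congʳ; setoid; rawMonoid)
  open import Algebra.Properties.CommutativeMonoid.Sum M using (sum; sum-permute; sum-cong-≋; ∑-distrib-+; sum-replicate)
  open import Algebra.Definitions.RawMonoid rawMonoid using () renaming (_×_ to _×ₘ_)
  open import Relation.Binary.Reasoning.Setoid setoid

  sum-permute-scaled : ∀ {N} (f : Fin N → Carrier) u (π : Permutation′ N) →
                       (∀ i → f (π ⟨$⟩ʳ i) ≈ u ∙ f i) → sum f ≈ (N ×ₘ u) ∙ sum f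
  sum-permute-scaled {N} f u π fπ≈uf = begin
    sum f                           ≈⟨ sum-permute f π ⟩
    sum (λ i → f (π ⟨$⟩ʳ i))         ≈⟨ sum-cong-≋ fπ≈uf ⟩
    sum (λ i → u ∙ f i)             ≈⟨ ∑-distrib-+ {N} (λ _ → u) f ⟩
    sum {N} (λ _ → u) ∙ sum f       ≈⟨ ∙-congʳ (sum-replicate N) ⟩
    (N ×ₘ u) ∙ sum f                 ∎

module Punctured {C : Set} {k : ℕ} (c : C ↔ Fin (suc k)) (x₀ : C) where
  open Inverse c

  enum : Fin k → C
  enum j = from (punchIn (to x₀) j)

  enum-≢ : ∀ j → enum j ≢ x₀
  enum-≢ j eq = Finₚ.punchInᵢ≢i (to x₀) j (trans (sym (strictlyInverseˡ _)) (cong to eq))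

  enum-injective : ∀ {i j} → enum i ≡ enum j → i ≡ j
  enum-injective {i} {j} eq = Finₚ.punchIn-injective (to x₀) i j
    (trans (sym (strictlyInverseˡ _)) (trans (cong to eq) (strictlyInverseˡ _)))

  index : (a : C) → a ≢ x₀ → Fin k
  index a a≢x₀ = punchOut {i = to x₀} {j = to a}
    (λ eq → a≢x₀ (trans (sym (strictlyInverseʳ a)) (trans (cong from (sym eq)) (strictlyInverseʳ x₀))))

  enum-index : ∀ a (a≢x₀ : a ≢ x₀) → enum (index a a≢x₀) ≡ a
  enum-index a _ = trans (cong from (Finₚ.punchIn-punchOut _)) (strictlyInverseʳ a)

  record Bijection : Set where
    field
      fun fun⁻¹ : C → C
      fun-≢ : ∀ {a} → a ≢ x₀ → fun a ≢ x₀
      fun⁻¹-≢ : ∀ {a} → a ≢ x₀ → fun⁻¹ a ≢ x₀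
      fun∘fun⁻¹ : ∀ {a} → a ≢ x₀ → fun (fun⁻¹ a) ≡ a
      fun⁻¹∘fun : ∀ {a} → a ≢ x₀ → fun⁻¹ (fun a) ≡ a

    private
      π π′ : Fin k → Fin k
      π i = index (fun (enum i)) (fun-≢ (enum-≢ i))
      π′ i = index (fun⁻¹ (enum i)) (fun⁻¹-≢ (enum-≢ i))

      enum-π : ∀ i → enum (π i) ≡ fun (enum i)
      enum-π i = enum-index (fun (enum i)) (fun-≢ (enum-≢ i))

      enum-π′ : ∀ i → enum (π′ i) ≡ fun⁻¹ (enum i)
      enum-π′ i = enum-index (fun⁻¹ (enum i)) (fun⁻¹-≢ (enum-≢ i))

    permutationOf : Permutation′ k
    permutationOf = permutation π π′
      (λ i → enum-injective (trans (enum-π (π′ i)) (trans (cong fun (enum-π′ i)) (fun∘fun⁻¹ (enum-≢ i)))))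
      (λ i → enum-injective (trans (enum-π′ (π i)) (trans (cong fun⁻¹ (enum-π i)) (fun⁻¹∘fun (enum-≢ i)))))

    enum-permutationOf : ∀ i → enum (permutationOf ⟨$⟩ʳ i) ≡ fun (enum i)
    enum-permutationOf = enum-π

  module _ {c ℓ} (M : CommutativeMonoid c ℓ) where
    open CommutativeMonoid M using (Carrier; _≈_; _∙_; rawMonoid; reflexive) renaming (trans to ≈-trans)
    open import Algebra.Properties.CommutativeMonoid.Sum M using (sum)
    open import Algebra.Definitions.RawMonoid rawMonoid using () renaming (_×_ to _×ₘ_)

    sum-punctured-scaled : (φ : C → Carrier) (u : Carrier) (b : Bijection) →
                           (∀ {a} → a ≢ x₀ → φ (Bijection.fun b a) ≈ u ∙ φ a) →
                           sum (φ ∘ enum) ≈ (k ×ₘ u) ∙ sum (φ ∘ enum)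
    sum-punctured-scaled φ u b φ-fun = ScaledSum.sum-permute-scaled M (φ ∘ enum) u (permutationOf b)
      (λ i → ≈-trans (reflexive (cong φ (enum-permutationOf b i))) (φ-fun (enum-≢ i)))
      where open Bijection

funToFin-cong : ∀ {k r} {f g : Fin k → Fin r} → (∀ i → f i ≡ g i) → Fin.funToFin f ≡ Fin.funToFin g
funToFin-cong {zero} _ = refl
funToFin-cong {suc k} {r} f≗g = cong₂ (Fin.combine {n = r ℕ.^ k}) (f≗g Fin.zero) (funToFin-cong (f≗g ∘ Fin.suc))

Vec↔Fin^ : ∀ {C : Set} {r} → C ↔ Fin r → ∀ k → Vec C k ↔ Fin (r ℕ.^ k)
Vec↔Fin^ {C} {r} c k = mk↔ₛ′ to′ from′ to∘from from∘to
  where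
  open Inverse c
  to′ : Vec C k → Fin (r ℕ.^ k)
  to′ v = Fin.funToFin (to ∘ Vec.lookup v)
  from′ : Fin (r ℕ.^ k) → Vec C k
  from′ j = Vec.tabulate (from ∘ Fin.finToFun j)
  to∘from : ∀ j → to′ (from′ j) ≡ j
  to∘from j = trans (funToFin-cong {k} {r} (λ i → trans (cong to (Vecₚ.lookup∘tabulate _ i)) (strictlyInverseˡ _)))
                    (Finₚ.funToFin-finToFin {k} {r} j)
  from∘to : ∀ v → from′ (to′ v) ≡ v
  from∘to v = trans (Vecₚ.tabulate-cong (λ i → trans (cong from (Finₚ.finToFun-funToFin _ i)) (strictlyInverseʳ _)))
                    (Vecₚ.tabulate∘lookup v)

↔Fin-suc : ∀ {A : Set} {q} → A → A ↔ Fin q → A ↔ Fin (suc (q ∸ 1))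
↔Fin-suc {q = suc _} _ c = c
↔Fin-suc {q = zero}  a c with () ← Inverse.to c a

∣∧<⇒≡0 : ∀ {a δ} → a ∣ δ → δ < a → δ ≡ 0
∣∧<⇒≡0 {δ = zero}  _   _   = refl
∣∧<⇒≡0 {δ = suc _} a∣δ δ<a = ⊥-elim (>⇒∤ δ<a a∣δ)

div≡/ : ∀ a b .{{_ : NonZero b}} → a div b ≡ a / b
div≡/ a (suc b) = refl

p∣[1+p]^m∸1 : ∀ p m → p ∣ suc p ℕ.^ m ∸ 1
p∣[1+p]^m∸1 p zero    = divides 0 refl
p∣[1+p]^m∸1 p (suc m) with p∣[1+p]^m∸1 p m
... | divides k a∸1≡kp = divides (suc p ℕ.* k ℕ.+ 1) (begin
  suc p ℕ.* a ∸ 1                           ≡⟨ cong (λ x → suc p ℕ.* x ∸ 1) (sym (ℕₚ.m∸n+n≡m (ℕₚ.m^n>0 (suc p) m))) ⟩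
  suc p ℕ.* ((a ∸ 1) ℕ.+ 1) ∸ 1             ≡⟨ cong (λ x → suc p ℕ.* (x ℕ.+ 1) ∸ 1) a∸1≡kp ⟩
  suc p ℕ.* (k ℕ.* p ℕ.+ 1) ∸ 1             ≡⟨ cong (_∸ 1) (expand p k) ⟩
  (suc p ℕ.* k ℕ.+ 1) ℕ.* p                 ∎)
  where
  a = suc p ℕ.^ m
  expand : ∀ p k → suc p ℕ.* (k ℕ.* p ℕ.+ 1) ≡ suc ((suc p ℕ.* k ℕ.+ 1) ℕ.* p)
  expand = solve-∀
  open ≡-Reasoning

q∸1∣q^m∸1 : ∀ {q} m → 1 ≤ q → q ∸ 1 ∣ q ℕ.^ m ∸ 1
q∸1∣q^m∸1 {suc p} m _ = p∣[1+p]^m∸1 p m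

q≤q^m : ∀ {q m} → 1 ≤ q → 1 ≤ m → q ≤ q ℕ.^ m
q≤q^m {q} {m} 1≤q 1≤m = subst (_≤ q ℕ.^ m) (ℕₚ.^-identityʳ q) (ℕₚ.^-monoʳ-≤ q ⦃ ℕ.>-nonZero 1≤q ⦄ 1≤m)

module GcdQuotient (N n : ℕ) (1≤N : 1 ≤ N) (1≤n : 1 ≤ n) where
  open ≡-Reasoning

  instance
    N-nonZero : NonZero N
    N-nonZero = ℕ.>-nonZero 1≤N
    n-nonZero : NonZero n
    n-nonZero = ℕ.>-nonZero 1≤n

  d : ℕ
  d = gcd N n

  instance
    d-nonZero : NonZero d
    d-nonZero = ℕ.≢-nonZero (gcd[m,n]≢0 N n (inj₂ (ℕ.≢-nonZero⁻¹ n)))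

  t : ℕ
  t = n / d

  1≤d : 1 ≤ d
  1≤d = ℕ.>-nonZero⁻¹ d

  d≤N : d ≤ N
  d≤N = ∣⇒≤ (gcd[m,n]∣m N n)

  t*d≡n : t ℕ.* d ≡ n
  t*d≡n = m/n*n≡m (gcd[m,n]∣n N n)

  1≤t : 1 ≤ t
  1≤t = m≥n⇒m/n>0 (∣⇒≤ (gcd[m,n]∣n N n))

  instance
    t-nonZero : NonZero t
    t-nonZero = ℕ.>-nonZero 1≤t

  N′ : ℕ
  N′ = N / d

  N′*d≡N : N′ ℕ.* d ≡ N
  N′*d≡N = m/n*n≡m (gcd[m,n]∣m N n)

  n∣N*t : n ∣ N ℕ.* t
  n∣N*t = divides N′ (begin
    N ℕ.* t              ≡⟨ cong (ℕ._* t) (sym N′*d≡N) ⟩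
    N′ ℕ.* d ℕ.* t       ≡⟨ ℕₚ.*-assoc N′ d t ⟩
    N′ ℕ.* (d ℕ.* t)     ≡⟨ cong (N′ ℕ.*_) (trans (ℕₚ.*-comm d t) t*d≡n) ⟩
    N′ ℕ.* n             ∎)

  -- n = t d and N = N′ d with t, N′ coprime.
  n∣N*e⇒t∣e : ∀ e → n ∣ N ℕ.* e → t ∣ e
  n∣N*e⇒t∣e e n∣Ne = coprime-divisor (Coprimality.sym (coprime-/gcd N n))
    (*-cancelʳ-∣ d (subst₂ _∣_ (sym t*d≡n) Ne≡N′ed n∣Ne))
    where
    Ne≡N′ed : N ℕ.* e ≡ N′ ℕ.* e ℕ.* d
    Ne≡N′ed = begin
      N ℕ.* e              ≡⟨ cong (ℕ._* e) (sym N′*d≡N) ⟩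
      N′ ℕ.* d ℕ.* e       ≡⟨ ℕₚ.*-assoc N′ d e ⟩
      N′ ℕ.* (d ℕ.* e)     ≡⟨ cong (N′ ℕ.*_) (ℕₚ.*-comm d e) ⟩
      N′ ℕ.* (e ℕ.* d)     ≡⟨ sym (ℕₚ.*-assoc N′ e d) ⟩
      N′ ℕ.* e ℕ.* d       ∎

  n∣δ*t⇒d∣δ : ∀ δ → n ∣ δ ℕ.* t → d ∣ δ
  n∣δ*t⇒d∣δ δ n∣δt = *-cancelʳ-∣ t (subst (_∣ δ ℕ.* t) (trans (sym t*d≡n) (ℕₚ.*-comm t d)) n∣δt)

  module _ (Q : ℕ) (N∣Q : N ∣ Q) (n∣Q : n ∣ Q) (N≤Q : N ≤ Q) where
    1≤Q/N : 1 ≤ Q / N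
    1≤Q/N = m≥n⇒m/n>0 N≤Q

    t∣Q/N : t ∣ Q / N
    t∣Q/N = n∣N*e⇒t∣e (Q / N) (subst (n ∣_) (trans (sym (m/n*n≡m N∣Q)) (ℕₚ.*-comm (Q / N) N)) n∣Q)

    t≤Q/N : t ≤ Q / N
    t≤Q/N = ∣⇒≤ ⦃ ℕ.>-nonZero 1≤Q/N ⦄ t∣Q/N

≡-by-shifts : ∀ {bound} (P : ℕ → ℕ → Set) → (∀ {a b} → P a b → P b a) →
              (∀ a δ → a ℕ.+ δ < bound → P a (a ℕ.+ δ) → δ ≡ 0) →
              ∀ {a b} → a < bound → b < bound → P a b → a ≡ b
≡-by-shifts P P-sym shift≡0 {a} {b} a<bound b<bound Pab with ℕₚ.≤-total a b
... | inj₁ a≤b with ℕₚ.m≤n⇒∃[o]m+o≡n a≤b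
...   | δ , refl = sym (trans (cong (a ℕ.+_) (shift≡0 a δ b<bound Pab)) (ℕₚ.+-identityʳ a))
≡-by-shifts P P-sym shift≡0 {a} {b} a<bound b<bound Pab | inj₂ b≤a with ℕₚ.m≤n⇒∃[o]m+o≡n b≤a
...   | δ , refl = trans (cong (b ℕ.+_) (shift≡0 b δ a<bound (P-sym Pab))) (ℕₚ.+-identityʳ b)

module FieldProperties {q : ℕ} (F : FiniteField q) where
  open FiniteField F public using (Carrier; 0#; 1#; 0≢1; card)

  commutativeRing : CommutativeRing 0ℓ 0ℓ
  commutativeRing = record { isCommutativeRing = FiniteField.isCommutativeRing F }

  open CommutativeRing commutativeRing public
    using ( _+_; _*_; -_; +-assoc; +-comm; +-identityˡ; +-identityʳ; -‿inverseˡ; -‿inverseʳ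
          ; *-assoc; *-comm; *-identityˡ; *-identityʳ; distribˡ; distribʳ; *-commutativeMonoid)
    renaming (zeroˡ to *-zeroˡ; zeroʳ to *-zeroʳ)
  open import Algebra.Properties.Ring (CommutativeRing.ring commutativeRing) public
    using (-‿distribˡ-*; -0#≈0#)
  open import Algebra.Properties.CommutativeSemigroup
    (CommutativeMonoid.commutativeSemigroup (CommutativeRing.+-commutativeMonoid commutativeRing)) public
    using () renaming (interchange to +-interchange; x∙yz≈y∙xz to x+[y+z]≡y+[x+z])
  open import Algebra.Definitions.RawSemiring (Semiring.rawSemiring (CommutativeRing.semiring commutativeRing)) public
    using (_^_)
  open import Algebra.Properties.CommutativeMonoid.Sum *-commutativeMonoid
    using () renaming (sum to product)

  almostCommutativeRing : ACR.AlmostCommutativeRing 0ℓ 0ℓ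
  almostCommutativeRing = ACR.fromCommutativeRing commutativeRing (λ _ → nothing)

  module Solver = Tactic.RingSolver.NonReflective almostCommutativeRing

  open ≡-Reasoning

  _≟_ : DecidableEquality Carrier
  a ≟ b = Dec.map′ to-injective (cong to) (to a Fin.≟ to b)
    where
    open Inverse card using (to; from; strictlyInverseʳ)
    to-injective : to a ≡ to b → a ≡ b
    to-injective eq = trans (sym (strictlyInverseʳ a)) (trans (cong from eq) (strictlyInverseʳ b))

  1#≢0# : 1# ≢ 0#
  1#≢0# = 0≢1 ∘ sym

  inv : (a : Carrier) → a ≢ 0# → Carrier
  inv a a≢0 = proj₁ (FiniteField.inverse F a a≢0)

  *-inverseʳ : ∀ a (a≢0 : a ≢ 0#) → a * inv a a≢0 ≡ 1#
  *-inverseʳ a a≢0 = proj₂ (FiniteField.inverse F a a≢0)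

  *-inverseˡ : ∀ a (a≢0 : a ≢ 0#) → inv a a≢0 * a ≡ 1#
  *-inverseˡ a a≢0 = trans (*-comm _ _) (*-inverseʳ a a≢0)

  inv-≢0 : ∀ a (a≢0 : a ≢ 0#) → inv a a≢0 ≢ 0#
  inv-≢0 a a≢0 eq = 1#≢0# (begin
    1#               ≡⟨ sym (*-inverseˡ a a≢0) ⟩
    inv a a≢0 * a    ≡⟨ cong (_* a) eq ⟩
    0# * a           ≡⟨ *-zeroˡ a ⟩
    0#               ∎)

  inv-*-cancelˡ : ∀ a (a≢0 : a ≢ 0#) b → inv a a≢0 * (a * b) ≡ b
  inv-*-cancelˡ a a≢0 b = begin
    inv a a≢0 * (a * b)    ≡⟨ sym (*-assoc _ _ _) ⟩
    (inv a a≢0 * a) * b    ≡⟨ cong (_* b) (*-inverseˡ a a≢0) ⟩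
    1# * b                 ≡⟨ *-identityˡ b ⟩
    b                      ∎

  *-inv-cancelˡ : ∀ a (a≢0 : a ≢ 0#) b → a * (inv a a≢0 * b) ≡ b
  *-inv-cancelˡ a a≢0 b = begin
    a * (inv a a≢0 * b)    ≡⟨ sym (*-assoc _ _ _) ⟩
    (a * inv a a≢0) * b    ≡⟨ cong (_* b) (*-inverseʳ a a≢0) ⟩
    1# * b                 ≡⟨ *-identityˡ b ⟩
    b                      ∎

  *-inv-cancelʳ : ∀ a (a≢0 : a ≢ 0#) b → (b * inv a a≢0) * a ≡ b
  *-inv-cancelʳ a a≢0 b = begin
    (b * inv a a≢0) * a    ≡⟨ *-assoc _ _ _ ⟩
    b * (inv a a≢0 * a)    ≡⟨ cong (b *_) (*-inverseˡ a a≢0) ⟩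
    b * 1#                 ≡⟨ *-identityʳ b ⟩
    b                      ∎

  x≢0∧x*y≡0⇒y≡0 : ∀ {x y} → x ≢ 0# → x * y ≡ 0# → y ≡ 0#
  x≢0∧x*y≡0⇒y≡0 {x} {y} x≢0 xy≡0 = begin
    y                    ≡⟨ sym (inv-*-cancelˡ x x≢0 y) ⟩
    inv x x≢0 * (x * y)  ≡⟨ cong (inv x x≢0 *_) xy≡0 ⟩
    inv x x≢0 * 0#       ≡⟨ *-zeroʳ _ ⟩
    0#                   ∎

  *-≢0 : ∀ {a b} → a ≢ 0# → b ≢ 0# → a * b ≢ 0#
  *-≢0 a≢0 b≢0 = b≢0 ∘ x≢0∧x*y≡0⇒y≡0 a≢0

  ^-≢0 : ∀ {a} k → a ≢ 0# → a ^ k ≢ 0#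
  ^-≢0 zero    _   = 1#≢0#
  ^-≢0 (suc k) a≢0 = *-≢0 a≢0 (^-≢0 k a≢0)

  x-y≢0 : ∀ {x y} → y ≢ x → x + - y ≢ 0#
  x-y≢0 {x} {y} y≢x x-y≡0 = y≢x (sym (begin
    x                ≡⟨ sym (+-identityʳ x) ⟩
    x + 0#           ≡⟨ cong (x +_) (sym (-‿inverseˡ y)) ⟩
    x + (- y + y)    ≡⟨ sym (+-assoc _ _ _) ⟩
    (x + - y) + y    ≡⟨ cong (_+ y) x-y≡0 ⟩
    0# + y           ≡⟨ +-identityˡ y ⟩
    y                ∎))

  product-≢0 : ∀ {k} (f : Fin k → Carrier) → (∀ i → f i ≢ 0#) → product f ≢ 0#
  product-≢0 {zero}  f f≢0 = 1#≢0#
  product-≢0 {suc k} f f≢0 = *-≢0 (f≢0 Fin.zero) (product-≢0 (f ∘ Fin.suc) (f≢0 ∘ Fin.suc))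

  x≡y*x⇒y≡1 : ∀ {x y} → x ≢ 0# → x ≡ y * x → y ≡ 1#
  x≡y*x⇒y≡1 {x} {y} x≢0 x≡yx = begin
    y                    ≡⟨ sym (*-identityʳ y) ⟩
    y * 1#               ≡⟨ cong (y *_) (sym (*-inverseʳ x x≢0)) ⟩
    y * (x * inv x x≢0)  ≡⟨ sym (*-assoc _ _ _) ⟩
    (y * x) * inv x x≢0  ≡⟨ cong (_* inv x x≢0) (sym x≡yx) ⟩
    x * inv x x≢0        ≡⟨ *-inverseʳ x x≢0 ⟩
    1#                   ∎

  -- Multiplication by α permutes the nonzero elements, so their product Π satisfies Π = α^(q-1) Π.
  fermat : ∀ α → α ≢ 0# → α ^ (q ∸ 1) ≡ 1#
  fermat α α≢0 = x≡y*x⇒y≡1 (product-≢0 enum enum-≢) Π≡αᴺΠ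
    where
    open Punctured (↔Fin-suc 0# card) 0#
    scaling : Bijection
    scaling = record
      { fun = α *_ ; fun⁻¹ = inv α α≢0 *_
      ; fun-≢ = *-≢0 α≢0 ; fun⁻¹-≢ = *-≢0 (inv-≢0 α α≢0)
      ; fun∘fun⁻¹ = λ {a} _ → *-inv-cancelˡ α α≢0 a
      ; fun⁻¹∘fun = λ {a} _ → inv-*-cancelˡ α α≢0 a }
    Π≡αᴺΠ : product enum ≡ α ^ (q ∸ 1) * product enum
    Π≡αᴺΠ = sum-punctured-scaled *-commutativeMonoid (λ a → a) α scaling (λ _ → refl)

module Polynomials {q : ℕ} (F : FiniteField q) where
  open FieldProperties F public
  open ≡-Reasoning

  cf : Poly F → ℕ → Carrier
  cf = coeff F

  -- Coefficientwise equality, as a record so that the two polynomials can be inferred from a proof.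
  infix 4 _≈_
  record _≈_ (f g : Poly F) : Set where
    constructor mk≈
    field at : ∀ k → cf f k ≡ cf g k
  open _≈_ public

  infixl 6 _⊞_
  infixl 7 _⊠_
  _⊞_ : Poly F → Poly F → Poly F
  _⊞_ = addP F
  _⊠_ : Poly F → Poly F → Poly F
  _⊠_ = mulP F
  ⊟ : Poly F → Poly F
  ⊟ = List.map -_
  scale : Carrier → Poly F → Poly F
  scale a = List.map (a *_)

  ≈-refl : ∀ {f} → f ≈ f
  ≈-refl = mk≈ (λ k → refl)
  ≈-sym : ∀ {f g} → f ≈ g → g ≈ f
  ≈-sym e = mk≈ (λ k → sym (at e k))
  ≈-trans : ∀ {f g h} → f ≈ g → g ≈ h → f ≈ h
  ≈-trans e e' = mk≈ (λ k → trans (at e k) (at e' k))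
  ≡⇒≈ : ∀ {f g} → f ≡ g → f ≈ g
  ≡⇒≈ refl = ≈-refl

  cf-⊞ : ∀ f g k → cf (f ⊞ g) k ≡ cf f k + cf g k
  cf-⊞ [] g k = sym (+-identityˡ _)
  cf-⊞ (a ∷ f) [] k = sym (+-identityʳ _)
  cf-⊞ (a ∷ f) (b ∷ g) zero = refl
  cf-⊞ (a ∷ f) (b ∷ g) (suc k) = cf-⊞ f g k

  cf-scale : ∀ a g k → cf (scale a g) k ≡ a * cf g k
  cf-scale a [] k = sym (*-zeroʳ a)
  cf-scale a (b ∷ g) zero = refl
  cf-scale a (b ∷ g) (suc k) = cf-scale a g k

  cf-⊟ : ∀ g k → cf (⊟ g) k ≡ - cf g k
  cf-⊟ [] k = sym -0#≈0#
  cf-⊟ (b ∷ g) zero = refl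
  cf-⊟ (b ∷ g) (suc k) = cf-⊟ g k

  ∷-cong : ∀ {a b f g} → a ≡ b → f ≈ g → (a ∷ f) ≈ (b ∷ g)
  ∷-cong a≡b f≈g = mk≈ λ { zero → a≡b ; (suc k) → at f≈g k }

  tail-≈ : ∀ {a b f g} → (a ∷ f) ≈ (b ∷ g) → f ≈ g
  tail-≈ e = mk≈ (λ k → at e (suc k))

  tail-≈[] : ∀ {a f} → (a ∷ f) ≈ [] → f ≈ []
  tail-≈[] e = mk≈ (λ k → at e (suc k))

  ⊞-cong : ∀ {f f′ g g′} → f ≈ f′ → g ≈ g′ → f ⊞ g ≈ f′ ⊞ g′
  ⊞-cong {f} {f′} {g} {g′} f≈f′ g≈g′ = mk≈ λ k → begin
    cf (f ⊞ g) k          ≡⟨ cf-⊞ f g k ⟩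
    cf f k + cf g k       ≡⟨ cong₂ _+_ (at f≈f′ k) (at g≈g′ k) ⟩
    cf f′ k + cf g′ k     ≡⟨ sym (cf-⊞ f′ g′ k) ⟩
    cf (f′ ⊞ g′) k        ∎

  ⊞-congʳ : ∀ {f f'} g → f ≈ f' → f ⊞ g ≈ f' ⊞ g
  ⊞-congʳ g e = ⊞-cong e (≈-refl {g})
  ⊞-congˡ : ∀ f {g g'} → g ≈ g' → f ⊞ g ≈ f ⊞ g'
  ⊞-congˡ f e = ⊞-cong (≈-refl {f}) e

  scale-cong : ∀ a {f g} → f ≈ g → scale a f ≈ scale a g
  scale-cong a {f} {g} e = mk≈ λ k → trans (cf-scale a f k) (trans (cong (a *_) (at e k)) (sym (cf-scale a g k)))

  ⊞-assoc : ∀ f g h → (f ⊞ g) ⊞ h ≈ f ⊞ (g ⊞ h)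
  ⊞-assoc f g h = mk≈ λ k → begin
    cf ((f ⊞ g) ⊞ h) k ≡⟨ cf-⊞ (f ⊞ g) h k ⟩
    cf (f ⊞ g) k + cf h k ≡⟨ cong (_+ cf h k) (cf-⊞ f g k) ⟩
    cf f k + cf g k + cf h k ≡⟨ +-assoc _ _ _ ⟩
    cf f k + (cf g k + cf h k) ≡⟨ cong (cf f k +_) (sym (cf-⊞ g h k)) ⟩
    cf f k + cf (g ⊞ h) k ≡⟨ sym (cf-⊞ f (g ⊞ h) k) ⟩
    cf (f ⊞ (g ⊞ h)) k ∎

  ⊞-comm : ∀ f g → f ⊞ g ≈ g ⊞ f
  ⊞-comm f g = mk≈ λ k → trans (cf-⊞ f g k) (trans (+-comm _ _) (sym (cf-⊞ g f k)))

  ⊞-identityˡ : ∀ f → [] ⊞ f ≈ f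
  ⊞-identityˡ f = ≈-refl

  ⊞-identityʳ : ∀ f → f ⊞ [] ≈ f
  ⊞-identityʳ f = mk≈ λ k → trans (cf-⊞ f [] k) (+-identityʳ _)

  ⊟-inverseˡ : ∀ f → ⊟ f ⊞ f ≈ []
  ⊟-inverseˡ f = mk≈ λ k → trans (cf-⊞ (⊟ f) f k) (trans (cong (_+ cf f k) (cf-⊟ f k)) (-‿inverseˡ _))

  ⊟-inverseʳ : ∀ f → f ⊞ ⊟ f ≈ []
  ⊟-inverseʳ f = ≈-trans (⊞-comm f (⊟ f)) (⊟-inverseˡ f)

  ⊟-cong : ∀ {f g} → f ≈ g → ⊟ f ≈ ⊟ g
  ⊟-cong {f} {g} e = mk≈ λ k → trans (cf-⊟ f k) (trans (cong -_ (at e k)) (sym (cf-⊟ g k)))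

  scale-0# : ∀ g → scale 0# g ≈ []
  scale-0# g = mk≈ λ k → trans (cf-scale 0# g k) (*-zeroˡ _)

  0∷[]≈[] : (0# ∷ []) ≈ []
  0∷[]≈[] = mk≈ λ { zero → refl ; (suc _) → refl }

  ⊠-zeroˡ : ∀ f g → f ≈ [] → f ⊠ g ≈ []
  ⊠-zeroˡ [] g e = ≈-refl
  ⊠-zeroˡ (a ∷ f) g e = mk≈ λ k → begin
    cf (scale a g ⊞ (0# ∷ f ⊠ g)) k ≡⟨ cf-⊞ (scale a g) (0# ∷ f ⊠ g) k ⟩
    cf (scale a g) k + cf (0# ∷ f ⊠ g) k ≡⟨ cong₂ _+_ (cf-scale a g k) (at (∷-cong refl (⊠-zeroˡ f g (tail-≈[] e))) k) ⟩
    a * cf g k + cf (0# ∷ []) k ≡⟨ cong₂ _+_ (cong (_* cf g k) (at e zero)) (at 0∷[]≈[] k) ⟩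
    0# * cf g k + 0# ≡⟨ trans (+-identityʳ _) (*-zeroˡ _) ⟩
    cf [] k ∎

  ⊠-congʳ : ∀ {f f'} g → f ≈ f' → f ⊠ g ≈ f' ⊠ g
  ⊠-congʳ {[]} {f'} g e = ≈-sym (⊠-zeroˡ f' g (≈-sym e))
  ⊠-congʳ {a ∷ f} {[]} g e = ⊠-zeroˡ (a ∷ f) g e
  ⊠-congʳ {a ∷ f} {b ∷ f'} g e =
    ⊞-cong (mk≈ λ k → trans (cf-scale a g k) (trans (cong (_* cf g k) (at e zero)) (sym (cf-scale b g k))))
           (∷-cong refl (⊠-congʳ g (tail-≈ e)))

  ⊠-congˡ : ∀ f {g g'} → g ≈ g' → f ⊠ g ≈ f ⊠ g'
  ⊠-congˡ [] e = ≈-refl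
  ⊠-congˡ (a ∷ f) e = ⊞-cong (scale-cong a e) (∷-cong refl (⊠-congˡ f e))

  ⊠-cong : ∀ {f f' g g'} → f ≈ f' → g ≈ g' → f ⊠ g ≈ f' ⊠ g'
  ⊠-cong {f} {f'} {g} {g'} e e' = ≈-trans (⊠-congʳ g e) (⊠-congˡ f' e')

  ⊞-interchange : ∀ f g h i → (f ⊞ g) ⊞ (h ⊞ i) ≈ (f ⊞ h) ⊞ (g ⊞ i)
  ⊞-interchange f g h i = mk≈ λ k → begin
    cf ((f ⊞ g) ⊞ (h ⊞ i)) k ≡⟨ cf-⊞ (f ⊞ g) (h ⊞ i) k ⟩
    cf (f ⊞ g) k + cf (h ⊞ i) k ≡⟨ cong₂ _+_ (cf-⊞ f g k) (cf-⊞ h i k) ⟩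
    (cf f k + cf g k) + (cf h k + cf i k) ≡⟨ +-interchange _ _ _ _ ⟩
    (cf f k + cf h k) + (cf g k + cf i k) ≡⟨ sym (cong₂ _+_ (cf-⊞ f h k) (cf-⊞ g i k)) ⟩
    cf (f ⊞ h) k + cf (g ⊞ i) k ≡⟨ sym (cf-⊞ (f ⊞ h) (g ⊞ i) k) ⟩
    cf ((f ⊞ h) ⊞ (g ⊞ i)) k ∎

  scale-+ : ∀ a b g → scale (a + b) g ≈ scale a g ⊞ scale b g
  scale-+ a b g = mk≈ λ k → begin
    cf (scale (a + b) g) k                ≡⟨ cf-scale (a + b) g k ⟩
    (a + b) * cf g k                      ≡⟨ distribʳ _ a b ⟩
    a * cf g k + b * cf g k               ≡⟨ sym (cong₂ _+_ (cf-scale a g k) (cf-scale b g k)) ⟩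
    cf (scale a g) k + cf (scale b g) k   ≡⟨ sym (cf-⊞ (scale a g) (scale b g) k) ⟩
    cf (scale a g ⊞ scale b g) k          ∎

  scale-⊞ : ∀ a f g → scale a (f ⊞ g) ≈ scale a f ⊞ scale a g
  scale-⊞ a f g = mk≈ λ k → begin
    cf (scale a (f ⊞ g)) k                ≡⟨ cf-scale a (f ⊞ g) k ⟩
    a * cf (f ⊞ g) k                      ≡⟨ cong (a *_) (cf-⊞ f g k) ⟩
    a * (cf f k + cf g k)                 ≡⟨ distribˡ a _ _ ⟩
    a * cf f k + a * cf g k               ≡⟨ sym (cong₂ _+_ (cf-scale a f k) (cf-scale a g k)) ⟩
    cf (scale a f) k + cf (scale a g) k   ≡⟨ sym (cf-⊞ (scale a f) (scale a g) k) ⟩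
    cf (scale a f ⊞ scale a g) k          ∎

  ⊠-distribʳ : ∀ f f' g → (f ⊞ f') ⊠ g ≈ f ⊠ g ⊞ f' ⊠ g
  ⊠-distribʳ [] f' g = ≈-refl
  ⊠-distribʳ (a ∷ f) [] g = ≈-sym (⊞-identityʳ _)
  ⊠-distribʳ (a ∷ f) (b ∷ f') g =
    ≈-trans (⊞-cong (scale-+ a b g) (≈-trans (∷-cong (sym (+-identityʳ 0#)) (⊠-distribʳ f f' g)) ≈-refl))
           (⊞-interchange (scale a g) (scale b g) (0# ∷ f ⊠ g) (0# ∷ f' ⊠ g))

  scale-scale : ∀ a b f → scale a (scale b f) ≈ scale (a * b) f
  scale-scale a b f = mk≈ λ k → begin
    cf (scale a (scale b f)) k    ≡⟨ cf-scale a (scale b f) k ⟩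
    a * cf (scale b f) k          ≡⟨ cong (a *_) (cf-scale b f k) ⟩
    a * (b * cf f k)              ≡⟨ sym (*-assoc a b _) ⟩
    (a * b) * cf f k              ≡⟨ sym (cf-scale (a * b) f k) ⟩
    cf (scale (a * b) f) k        ∎

  scale-⊠ : ∀ a f g → scale a f ⊠ g ≈ scale a (f ⊠ g)
  scale-⊠ a [] g = ≈-refl
  scale-⊠ a (b ∷ f) g =
    ≈-trans (⊞-cong (≈-sym (scale-scale a b g)) (∷-cong (sym (*-zeroʳ a)) (scale-⊠ a f g)))
           (≈-sym (scale-⊞ a (scale b g) (0# ∷ f ⊠ g)))

  0∷-⊠ : ∀ f g → (0# ∷ f) ⊠ g ≈ 0# ∷ f ⊠ g
  0∷-⊠ f g = ≈-trans (⊞-cong (scale-0# g) ≈-refl) (⊞-identityˡ _)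

  ⊠-assoc : ∀ f g h → (f ⊠ g) ⊠ h ≈ f ⊠ (g ⊠ h)
  ⊠-assoc [] g h = ≈-refl
  ⊠-assoc (a ∷ f) g h =
    ≈-trans (⊠-distribʳ (scale a g) (0# ∷ f ⊠ g) h)
           (⊞-cong (scale-⊠ a g h) (≈-trans (0∷-⊠ (f ⊠ g) h) (∷-cong refl (⊠-assoc f g h))))

  ⊠-∷ : ∀ f b g → f ⊠ (b ∷ g) ≈ scale b f ⊞ (0# ∷ f ⊠ g)
  ⊠-∷ [] b g = ≈-sym 0∷[]≈[]
  ⊠-∷ (a ∷ f) b g = mk≈ go
    where
    go : ∀ k → cf ((a ∷ f) ⊠ (b ∷ g)) k ≡ cf (scale b (a ∷ f) ⊞ (0# ∷ (a ∷ f) ⊠ g)) k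
    go zero = trans (+-identityʳ _) (trans (*-comm a b) (sym (+-identityʳ _)))
    go (suc k) = begin
      cf (scale a g ⊞ (f ⊠ (b ∷ g))) k ≡⟨ cf-⊞ (scale a g) (f ⊠ (b ∷ g)) k ⟩
      cf (scale a g) k + cf (f ⊠ (b ∷ g)) k ≡⟨ cong (cf (scale a g) k +_) (at (⊠-∷ f b g) k) ⟩
      cf (scale a g) k + cf (scale b f ⊞ (0# ∷ f ⊠ g)) k ≡⟨ cong (cf (scale a g) k +_) (cf-⊞ (scale b f) (0# ∷ f ⊠ g) k) ⟩
      cf (scale a g) k + (cf (scale b f) k + cf (0# ∷ f ⊠ g) k) ≡⟨ x+[y+z]≡y+[x+z] _ _ _ ⟩
      cf (scale b f) k + (cf (scale a g) k + cf (0# ∷ f ⊠ g) k)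
        ≡⟨ cong (cf (scale b f) k +_) (sym (cf-⊞ (scale a g) (0# ∷ f ⊠ g) k)) ⟩
      cf (scale b f) k + cf ((a ∷ f) ⊠ g) k ≡⟨ sym (cf-⊞ (scale b f) ((a ∷ f) ⊠ g) k) ⟩
      cf (scale b f ⊞ ((a ∷ f) ⊠ g)) k ∎

  ⊠-zeroʳ : ∀ g → g ⊠ [] ≈ []
  ⊠-zeroʳ [] = ≈-refl
  ⊠-zeroʳ (a ∷ g) = ≈-trans (∷-cong {0#} {0#} refl (⊠-zeroʳ g)) 0∷[]≈[]

  ⊠-comm : ∀ f g → f ⊠ g ≈ g ⊠ f
  ⊠-comm [] g = ≈-sym (⊠-zeroʳ g)
  ⊠-comm (a ∷ f) g = ≈-trans (⊞-cong ≈-refl (∷-cong refl (⊠-comm f g))) (≈-sym (⊠-∷ g a f))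

  scale-1# : ∀ f → scale 1# f ≈ f
  scale-1# f = mk≈ λ k → trans (cf-scale 1# f k) (*-identityˡ _)

  ⊠-identityˡ : ∀ g → (1# ∷ []) ⊠ g ≈ g
  ⊠-identityˡ g = ≈-trans (⊞-cong (scale-1# g) 0∷[]≈[]) (⊞-identityʳ g)

  ⊠-distribˡ : ∀ f g g' → f ⊠ (g ⊞ g') ≈ f ⊠ g ⊞ f ⊠ g'
  ⊠-distribˡ f g g' = ≈-trans (⊠-comm f _) (≈-trans (⊠-distribʳ g g' f) (⊞-cong (⊠-comm g f) (⊠-comm g' f)))

  ⊞-⊠-isCommutativeRing : IsCommutativeRing _≈_ _⊞_ _⊠_ ⊟ [] (1# ∷ [])
  ⊞-⊠-isCommutativeRing = record
    { isRing = record
      { +-isAbelianGroup = record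
        { isGroup = record
          { isMonoid = record
            { isSemigroup = record
              { isMagma = record
                { isEquivalence = record { refl = ≈-refl ; sym = ≈-sym ; trans = ≈-trans }
                ; ∙-cong = ⊞-cong }
              ; assoc = ⊞-assoc }
            ; identity = ⊞-identityˡ , ⊞-identityʳ }
          ; inverse = ⊟-inverseˡ , ⊟-inverseʳ
          ; ⁻¹-cong = ⊟-cong }
        ; comm = ⊞-comm }
      ; *-cong = ⊠-cong
      ; *-assoc = ⊠-assoc
      ; *-identity = ⊠-identityˡ , (λ g → ≈-trans (⊠-comm g _) (⊠-identityˡ g))
      ; distrib = ⊠-distribˡ , (λ x y z → ⊠-distribʳ y z x) }
    ; *-comm = ⊠-comm }

  polyRing : CommutativeRing 0ℓ 0ℓ
  polyRing = record { isCommutativeRing = ⊞-⊠-isCommutativeRing }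

  infix 8 X^_ X^_−_
  X^_ : ℕ → Poly F
  X^ e = List.replicate e 0# List.++ (1# ∷ [])

  X^_−_ : ℕ → Carrier → Poly F
  X^ e − β = X^ e ⊞ ((- β) ∷ [])

  cf-X^-≡ : ∀ e → cf (X^ e) e ≡ 1#
  cf-X^-≡ zero    = refl
  cf-X^-≡ (suc e) = cf-X^-≡ e

  cf-X^-> : ∀ e i → e < i → cf (X^ e) i ≡ 0#
  cf-X^-> zero    (suc i) _         = refl
  cf-X^-> (suc e) (suc i) (s≤s e<i) = cf-X^-> e i e<i

  ⊠-const : ∀ x c → x ⊠ (c ∷ []) ≈ scale c x
  ⊠-const x c = ≈-trans (⊠-∷ x c [])
    (≈-trans (⊞-congˡ (scale c x) (≈-trans (∷-cong refl (⊠-zeroʳ x)) 0∷[]≈[])) (⊞-identityʳ _))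

  ⊠-scale : ∀ a f g → f ⊠ scale a g ≈ scale a (f ⊠ g)
  ⊠-scale a f g = ≈-trans (⊠-comm f _) (≈-trans (scale-⊠ a g f) (scale-cong a (⊠-comm g f)))

  scale-cong-≡ : ∀ {x y} f → x ≡ y → scale x f ≈ scale y f
  scale-cong-≡ f refl = ≈-refl

  scale-inv-cancel : ∀ a f (a≢0 : a ≢ 0#) → scale (inv a a≢0) (scale a f) ≈ f
  scale-inv-cancel a f a≢0 = ≈-trans (scale-scale _ a f) (≈-trans (scale-cong-≡ f (*-inverseˡ a a≢0)) (scale-1# f))

  Deg0⇒const : ∀ p → Deg F p 0 → p ≈ (cf p 0 ∷ [])
  Deg0⇒const [] (a≢0 , _) = ⊥-elim (a≢0 refl)
  Deg0⇒const (a ∷ p) (a≢0 , hi) = ∷-cong refl (mk≈ λ k → hi (suc k) (s≤s z≤n))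

  DegreeBelow : Poly F → ℕ → Set
  DegreeBelow r k = ∀ i → k ≤ i → cf r i ≡ 0#

  DegreeBelow-pred : ∀ {r k} → DegreeBelow r (suc k) → cf r k ≡ 0# → DegreeBelow r k
  DegreeBelow-pred {r} {k} r<k+1 rₖ≡0 i k≤i with ℕₚ.m≤n⇒m<n∨m≡n k≤i
  ... | inj₁ k<i  = r<k+1 i k<i
  ... | inj₂ refl = rₖ≡0

  cf-⊞-scale : ∀ r a b i → cf (r ⊞ scale a b) i ≡ cf r i + a * cf b i
  cf-⊞-scale r a b i = trans (cf-⊞ r (scale a b) i) (cong (cf r i +_) (cf-scale a b i))

  eval : Poly F → Carrier → Carrier
  eval [] b = 0#
  eval (c ∷ p) b = c + b * eval p b

  synthDiv : Carrier → Poly F → Poly F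
  synthDiv β [] = []
  synthDiv β (c ∷ p) = eval p β ∷ synthDiv β p

  eval-≈[] : ∀ p b → p ≈ [] → eval p b ≡ 0#
  eval-≈[] [] b e = refl
  eval-≈[] (c ∷ p) b e = trans (cong₂ (λ x y → x + b * y) (at e zero) (eval-≈[] p b (tail-≈[] e)))
                               (trans (+-identityˡ _) (*-zeroʳ b))

  eval-cong : ∀ {p p'} b → p ≈ p' → eval p b ≡ eval p' b
  eval-cong {[]} {p'} b e = sym (eval-≈[] p' b (≈-sym e))
  eval-cong {c ∷ p} {[]} b e = eval-≈[] (c ∷ p) b e
  eval-cong {c ∷ p} {c' ∷ p'} b e = cong₂ (λ x y → x + b * y) (at e zero) (eval-cong b (tail-≈ e))

  eval-⊞ : ∀ p p′ b → eval (p ⊞ p′) b ≡ eval p b + eval p′ b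
  eval-⊞ []      p′       b = sym (+-identityˡ _)
  eval-⊞ (c ∷ p) []       b = sym (+-identityʳ _)
  eval-⊞ (c ∷ p) (c′ ∷ p′) b = begin
    (c + c′) + b * eval (p ⊞ p′) b               ≡⟨ cong (λ x → (c + c′) + b * x) (eval-⊞ p p′ b) ⟩
    (c + c′) + b * (eval p b + eval p′ b)        ≡⟨ solve 5 (λ c c′ b x y → ((c ⊕ c′) ⊕ b ⊗ (x ⊕ y)) ⊜ ((c ⊕ b ⊗ x) ⊕ (c′ ⊕ b ⊗ y)))
                                                       refl c c′ b (eval p b) (eval p′ b) ⟩
    (c + b * eval p b) + (c′ + b * eval p′ b)    ∎
    where open Solver using (solve; _⊕_; _⊗_; _⊜_)

  eval-X^ : ∀ e b → eval (X^ e) b ≡ b ^ e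
  eval-X^ zero b = trans (cong (1# +_) (*-zeroʳ b)) (+-identityʳ _)
  eval-X^ (suc e) b = trans (+-identityˡ _) (cong (b *_) (eval-X^ e b))

  eval-synthDiv : ∀ β p b → eval p b ≡ (b + - β) * eval (synthDiv β p) b + eval p β
  eval-synthDiv β []      b = sym (trans (+-identityʳ _) (*-zeroʳ _))
  eval-synthDiv β (c ∷ p) b = begin
    c + b * eval p b                          ≡⟨ cong (λ x → c + b * x) (eval-synthDiv β p b) ⟩
    c + b * ((b + - β) * s + r)               ≡⟨ sym (+-identityʳ _) ⟩
    c + b * ((b + - β) * s + r) + 0#          ≡⟨ cong (c + b * ((b + - β) * s + r) +_) (sym [-β+β]r≡0) ⟩
    c + b * ((b + - β) * s + r) + (- β + β) * r
      ≡⟨ solve 6 (λ c b -β β s r → (c ⊕ b ⊗ ((b ⊕ -β) ⊗ s ⊕ r) ⊕ (-β ⊕ β) ⊗ r) ⊜ ((b ⊕ -β) ⊗ (r ⊕ b ⊗ s) ⊕ (c ⊕ β ⊗ r)))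
           refl c b (- β) β s r ⟩
    (b + - β) * (r + b * s) + (c + β * r)     ∎
    where
    open Solver using (solve; _⊕_; _⊗_; _⊜_)
    s = eval (synthDiv β p) b
    r = eval p β
    [-β+β]r≡0 : (- β + β) * r ≡ 0#
    [-β+β]r≡0 = trans (cong (_* r) (-‿inverseˡ β)) (*-zeroˡ r)

  cf-drop : ∀ a p j → cf (List.drop a p) j ≡ cf p (a ℕ.+ j)
  cf-drop zero p j = refl
  cf-drop (suc a) [] j = refl
  cf-drop (suc a) (c ∷ p) j = cf-drop a p j

  cf-synthDiv : ∀ β p i → cf (synthDiv β p) i ≡ eval (List.drop (suc i) p) β
  cf-synthDiv β [] i = refl
  cf-synthDiv β (c ∷ p) zero = refl
  cf-synthDiv β (c ∷ p) (suc i) = cf-synthDiv β p i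

  Monic : Poly F → ℕ → Set
  Monic p k = cf p k ≡ 1# × DegreeBelow p (suc k)

  Monic-synthDiv : ∀ β p k → Monic p (suc k) → Monic (synthDiv β p) k
  Monic-synthDiv β p k (pₖ₊₁≡1 , p<k+2) = leading , vanishing
    where
    top≈1 : List.drop (suc k) p ≈ (1# ∷ [])
    top≈1 = mk≈ λ
      { zero    → trans (cf-drop (suc k) p 0) (trans (cong (cf p) (ℕₚ.+-identityʳ (suc k))) pₖ₊₁≡1)
      ; (suc j) → trans (cf-drop (suc k) p (suc j)) (p<k+2 _ (s≤s (ℕₚ.m<m+n k (s≤s z≤n)))) }
    leading : cf (synthDiv β p) k ≡ 1#
    leading = trans (cf-synthDiv β p k) (trans (eval-cong β top≈1) (trans (cong (1# +_) (*-zeroʳ β)) (+-identityʳ _)))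
    vanishing : DegreeBelow (synthDiv β p) (suc k)
    vanishing i k<i = trans (cf-synthDiv β p i) (eval-≈[] (List.drop (suc i) p) β
      (mk≈ λ j → trans (cf-drop (suc i) p j) (p<k+2 _ (ℕₚ.≤-trans (s≤s k<i) (ℕₚ.m≤m+n (suc i) j)))))

  Monic0⇒1 : ∀ p → Monic p 0 → p ≈ (1# ∷ [])
  Monic0⇒1 p (p₀≡1 , p<1) = mk≈ λ { zero → p₀≡1 ; (suc j) → p<1 (suc j) (s≤s z≤n) }

  Monic-X^− : ∀ {e} → 1 ≤ e → ∀ β → Monic (X^ e − β) e
  Monic-X^− {e} 1≤e β = leading , vanishing
    where
    const-vanishes : ∀ i → 1 ≤ i → cf ((- β) ∷ []) i ≡ 0#
    const-vanishes (suc i) _ = refl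
    leading : cf (X^ e − β) e ≡ 1#
    leading = trans (cf-⊞ (X^ e) _ e) (trans (cong₂ _+_ (cf-X^-≡ e) (const-vanishes e 1≤e)) (+-identityʳ _))
    vanishing : DegreeBelow (X^ e − β) (suc e)
    vanishing i e<i = trans (cf-⊞ (X^ e) _ i)
      (trans (cong₂ _+_ (cf-X^-> e i e<i) (const-vanishes i (ℕₚ.≤-trans 1≤e (ℕₚ.<⇒≤ e<i)))) (+-identityʳ _))

  eval-X^− : ∀ e β b → eval (X^ e − β) b ≡ b ^ e + - β
  eval-X^− e β b = trans (eval-⊞ (X^ e) _ b) (cong₂ _+_ (eval-X^ e b) (trans (cong (- β +_) (*-zeroʳ b)) (+-identityʳ _)))

  DegreeBelow-length : ∀ c → DegreeBelow c (List.length c)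
  DegreeBelow-length []      _       _         = refl
  DegreeBelow-length (a ∷ c) (suc i) (s≤s len≤i) = DegreeBelow-length c i len≤i

  cf-⊠-top : ∀ f g a b → DegreeBelow f (suc a) → DegreeBelow g (suc b) → cf (f ⊠ g) (a ℕ.+ b) ≡ cf f a * cf g b
  cf-⊠-top []      g a       b f<a+1 g<b+1 = sym (*-zeroˡ _)
  cf-⊠-top (c ∷ f) g zero    b f<1   g<b+1 = trans (cf-⊞ (scale c g) (0# ∷ f ⊠ g) b)
    (trans (cong₂ _+_ (cf-scale c g b) (shifted-vanishes b)) (+-identityʳ _))
    where
    shifted-vanishes : ∀ b → cf (0# ∷ f ⊠ g) b ≡ 0#
    shifted-vanishes zero    = refl
    shifted-vanishes (suc b) = at (⊠-zeroˡ f g (mk≈ λ i → f<1 (suc i) (s≤s z≤n))) b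
  cf-⊠-top (c ∷ f) g (suc a) b f<a+2 g<b+1 = trans (cf-⊞ (scale c g) (0# ∷ f ⊠ g) (suc (a ℕ.+ b)))
    (trans (cong₂ _+_ (trans (cf-scale c g _) (trans (cong (c *_) (g<b+1 _ (s≤s (ℕₚ.m≤n+m b a)))) (*-zeroʳ c)))
                      (cf-⊠-top f g a b (λ i a<i → f<a+2 (suc i) (s≤s a<i)) g<b+1))
           (+-identityˡ _))

  X^-+ : ∀ a b → X^ a ⊠ X^ b ≈ X^ (a ℕ.+ b)
  X^-+ zero    b = ⊠-identityˡ (X^ b)
  X^-+ (suc a) b = ≈-trans (0∷-⊠ (X^ a) (X^ b)) (∷-cong refl (X^-+ a b))

  toPoly : ∀ {k} → Vec Carrier k → Poly F
  toPoly = Vec.toList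

  fromPoly : ∀ k → Poly F → Vec Carrier k
  fromPoly zero    r = []
  fromPoly (suc k) r = cf r 0 ∷ fromPoly k (List.drop 1 r)

  toPoly-DegreeBelow : ∀ {k} (u : Vec Carrier k) → DegreeBelow (toPoly u) k
  toPoly-DegreeBelow []      i       _         = refl
  toPoly-DegreeBelow (a ∷ u) (suc i) (s≤s k≤i) = toPoly-DegreeBelow u i k≤i

  toPoly-injective : ∀ {k} (u v : Vec Carrier k) → toPoly u ≈ toPoly v → u ≡ v
  toPoly-injective []      []      _ = refl
  toPoly-injective (a ∷ u) (b ∷ v) e = cong₂ _∷_ (at e zero) (toPoly-injective u v (tail-≈ e))

  toPoly-fromPoly : ∀ k r → DegreeBelow r k → toPoly (fromPoly k r) ≈ r
  toPoly-fromPoly zero    r       r<0   = ≈-sym (mk≈ λ i → r<0 i z≤n)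
  toPoly-fromPoly (suc k) []      _     = ≈-trans (∷-cong refl (toPoly-fromPoly k [] (λ _ _ → refl))) 0∷[]≈[]
  toPoly-fromPoly (suc k) (c ∷ r) r<k+1 = ∷-cong refl (toPoly-fromPoly k r (λ i k≤i → r<k+1 (suc i) (s≤s k≤i)))

  toPoly-zeros : ∀ k → toPoly (Vec.replicate k 0#) ≈ []
  toPoly-zeros zero    = ≈-refl
  toPoly-zeros (suc k) = ≈-trans (∷-cong refl (toPoly-zeros k)) 0∷[]≈[]

module PolynomialDivision {q : ℕ} (F : FiniteField q) where
  open Polynomials F public

  polyAlmostCommutativeRing : ACR.AlmostCommutativeRing 0ℓ 0ℓ
  polyAlmostCommutativeRing = ACR.fromCommutativeRing polyRing (λ _ → nothing)

  module PS = Tactic.RingSolver.NonReflective polyAlmostCommutativeRing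

  open import Algebra.Properties.Ring (CommutativeRing.ring polyRing)
    using () renaming (-‿distribˡ-* to ⊟-distribˡ; -‿distribʳ-* to ⊟-distribʳ)
  module ≈-Reasoning = Relation.Binary.Reasoning.Setoid (CommutativeRing.setoid polyRing)

  infix 4 _∣ₚ_
  _∣ₚ_ : Poly F → Poly F → Set
  a ∣ₚ b = Σ (Poly F) λ c → a ⊠ c ≈ b

  ∣P⇒∣ₚ : ∀ {a b} → _∣P_ F a b → a ∣ₚ b
  ∣P⇒∣ₚ (c , e) = c , mk≈ e

  ∣ₚ⇒∣P : ∀ {a b} → a ∣ₚ b → _∣P_ F a b
  ∣ₚ⇒∣P (c , e) = c , at e

  ⊞-move : ∀ x y z → x ≈ y ⊞ z → z ≈ x ⊞ ⊟ y
  ⊞-move x y z x≈y+z = begin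
    z                ≈⟨ ≈-sym (⊞-identityˡ z) ⟩
    [] ⊞ z           ≈⟨ ⊞-congʳ z (≈-sym (⊟-inverseʳ y)) ⟩
    (y ⊞ ⊟ y) ⊞ z    ≈⟨ PS.solve 3 (λ a b c → ((a PS.⊕ b) PS.⊕ c) PS.⊜ ((a PS.⊕ c) PS.⊕ b)) ≈-refl y (⊟ y) z ⟩
    (y ⊞ z) ⊞ ⊟ y    ≈⟨ ⊞-congʳ (⊟ y) (≈-sym x≈y+z) ⟩
    x ⊞ ⊟ y          ∎
    where open ≈-Reasoning

  scale-inverse : ∀ s b → scale s b ⊞ scale (- s) b ≈ []
  scale-inverse s b = ≈-trans (≈-sym (scale-+ s (- s) b)) (≈-trans (scale-cong-≡ b (-‿inverseʳ s)) (scale-0# b))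

  cancel-leading : ∀ {k} b (lc≢0 : cf b k ≢ 0#) → DegreeBelow b (suc k) → ∀ r → DegreeBelow r (suc k) →
                   DegreeBelow (r ⊞ scale (- (cf r k * inv (cf b k) lc≢0)) b) k
  cancel-leading {k} b lc≢0 b<k+1 r r<k+1 = vanishes
    where
    s = cf r k * inv (cf b k) lc≢0
    vanishes : DegreeBelow (r ⊞ scale (- s) b) k
    vanishes i k≤i with ℕₚ.m≤n⇒m<n∨m≡n k≤i
    ... | inj₁ k<i = begin
      cf (r ⊞ scale (- s) b) i     ≡⟨ cf-⊞-scale r (- s) b i ⟩
      cf r i + - s * cf b i        ≡⟨ cong₂ (λ x y → x + - s * y) (r<k+1 i k<i) (b<k+1 i k<i) ⟩
      0# + - s * 0#                ≡⟨ trans (+-identityˡ _) (*-zeroʳ _) ⟩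
      0#                           ∎
      where open ≡-Reasoning
    ... | inj₂ refl = begin
      cf (r ⊞ scale (- s) b) k     ≡⟨ cf-⊞-scale r (- s) b k ⟩
      cf r k + - s * cf b k        ≡⟨ cong (cf r k +_) (sym (-‿distribˡ-* s (cf b k))) ⟩
      cf r k + - (s * cf b k)      ≡⟨ cong (λ x → cf r k + - x) (*-inv-cancelʳ (cf b k) lc≢0 (cf r k)) ⟩
      cf r k + - cf r k            ≡⟨ -‿inverseʳ _ ⟩
      0#                           ∎
      where open ≡-Reasoning

  -- Divide the tail of a first; prepending its constant term leaves a remainder of degree ≤ k,
  -- whose top coefficient a multiple of b cancels.
  divMod : ∀ {k} b → Deg F b k → ∀ a →
           Σ (Poly F) λ quot → Σ (Poly F) λ rem → (a ≈ b ⊠ quot ⊞ rem) × DegreeBelow rem k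
  divMod b deg-b [] = [] , [] , ≈-sym (≈-trans (⊞-identityʳ _) (⊠-zeroʳ b)) , λ _ _ → refl
  divMod {k} b deg-b@(lc≢0 , b<k+1) (c ∷ a) with divMod b deg-b a
  ... | quot , rem , a≈bq+r , rem<k =
    (0# ∷ quot) ⊞ (s ∷ []) , rem′ , c∷a≈ , cancel-leading b lc≢0 b<k+1 (c ∷ rem) c∷rem<k+1
    where
    s = cf (c ∷ rem) k * inv (cf b k) lc≢0
    rem′ = (c ∷ rem) ⊞ scale (- s) b
    c∷rem<k+1 : DegreeBelow (c ∷ rem) (suc k)
    c∷rem<k+1 (suc j) (s≤s k≤j) = rem<k j k≤j
    c∷a≈ : (c ∷ a) ≈ b ⊠ ((0# ∷ quot) ⊞ (s ∷ [])) ⊞ rem′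
    c∷a≈ = begin
      c ∷ a                                                  ≈⟨ ∷-cong (sym (+-identityˡ c)) a≈bq+r ⟩
      (0# ∷ b ⊠ quot) ⊞ (c ∷ rem)
        ≈⟨ ⊞-congʳ (c ∷ rem) (≈-sym (≈-trans (⊠-∷ b 0# quot) (⊞-congʳ (0# ∷ b ⊠ quot) (scale-0# b)))) ⟩
      b ⊠ (0# ∷ quot) ⊞ (c ∷ rem)
        ≈⟨ ⊞-congˡ (b ⊠ (0# ∷ quot)) (≈-sym (≈-trans (⊞-congˡ (c ∷ rem) (scale-inverse s b)) (⊞-identityʳ _))) ⟩
      b ⊠ (0# ∷ quot) ⊞ ((c ∷ rem) ⊞ (scale s b ⊞ scale (- s) b))
                                  ≈⟨ PS.solve 4 (λ x y u v → (x PS.⊕ (y PS.⊕ (u PS.⊕ v))) PS.⊜ ((x PS.⊕ u) PS.⊕ (y PS.⊕ v)))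
                                       ≈-refl (b ⊠ (0# ∷ quot)) (c ∷ rem) (scale s b) (scale (- s) b) ⟩
      (b ⊠ (0# ∷ quot) ⊞ scale s b) ⊞ rem′                   ≈⟨ ⊞-congʳ rem′ (⊞-congˡ (b ⊠ (0# ∷ quot)) (≈-sym (⊠-const b s))) ⟩
      (b ⊠ (0# ∷ quot) ⊞ b ⊠ (s ∷ [])) ⊞ rem′                ≈⟨ ⊞-congʳ rem′ (≈-sym (⊠-distribˡ b (0# ∷ quot) (s ∷ []))) ⟩
      b ⊠ ((0# ∷ quot) ⊞ (s ∷ [])) ⊞ rem′                    ∎
      where open ≈-Reasoning

  ≈[]⊎Deg : ∀ k r → DegreeBelow r k → r ≈ [] ⊎ Σ ℕ λ j → j < k × Deg F r j
  ≈[]⊎Deg zero    r r<0   = inj₁ (mk≈ λ i → r<0 i z≤n)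
  ≈[]⊎Deg (suc k) r r<k+1 with cf r k ≟ 0#
  ... | no  rₖ≢0 = inj₂ (k , ℕₚ.≤-refl , rₖ≢0 , r<k+1)
  ... | yes rₖ≡0 with ≈[]⊎Deg k r (DegreeBelow-pred {r} r<k+1 rₖ≡0)
  ...   | inj₁ r≈[]              = inj₁ r≈[]
  ...   | inj₂ (j , j<k , deg-r) = inj₂ (j , ℕₚ.m≤n⇒m≤1+n j<k , deg-r)

  record Bezout (a b : Poly F) : Set where
    field
      g u v : Poly F
      g≈ua+vb : g ≈ u ⊠ a ⊞ v ⊠ b
      g∣a : g ∣ₚ a
      g∣b : g ∣ₚ b

  -- Euclid's algorithm; the fuel bounds the degree of b, which drops at each step.
  bezout : ∀ fuel {k} → k < fuel → ∀ b → Deg F b k → ∀ a → Bezout a b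
  bezout (suc fuel) {k} k<fuel b deg-b a with divMod b deg-b a
  ... | quot , r , a≈bq+r , r<k with ≈[]⊎Deg k r r<k
  ... | inj₁ r≈[] = record
    { g = b ; u = [] ; v = 1# ∷ [] ; g≈ua+vb = ≈-sym (⊠-identityˡ b)
    ; g∣a = quot , ≈-sym (≈-trans a≈bq+r (≈-trans (⊞-congˡ (b ⊠ quot) r≈[]) (⊞-identityʳ _)))
    ; g∣b = 1# ∷ [] , ≈-trans (⊠-comm b _) (⊠-identityˡ b) }
  ... | inj₂ (j , j<k , deg-r) = record
    { g = g ; u = v ; v = u ⊞ ⊟ (v ⊠ quot) ; g≈ua+vb = g≈va+[u-vq]b ; g∣a = c ⊠ quot ⊞ d , g[cq+d]≈a ; g∣b = g∣a }
    where
    open Bezout (bezout fuel (ℕₚ.≤-trans j<k (ℕₚ.≤-pred k<fuel)) r deg-r b)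
    c = proj₁ g∣a
    d = proj₁ g∣b
    g≈va+[u-vq]b : g ≈ v ⊠ a ⊞ (u ⊞ ⊟ (v ⊠ quot)) ⊠ b
    g≈va+[u-vq]b = begin
      g                                       ≈⟨ g≈ua+vb ⟩
      u ⊠ b ⊞ v ⊠ r                           ≈⟨ ⊞-congˡ (u ⊠ b) (⊠-congˡ v (⊞-move a (b ⊠ quot) r a≈bq+r)) ⟩
      u ⊠ b ⊞ v ⊠ (a ⊞ ⊟ (b ⊠ quot))          ≈⟨ ⊞-congˡ (u ⊠ b) (⊠-distribˡ v a _) ⟩
      u ⊠ b ⊞ (v ⊠ a ⊞ v ⊠ ⊟ (b ⊠ quot))      ≈⟨ ⊞-congˡ (u ⊠ b) (⊞-congˡ (v ⊠ a) (≈-sym (⊟-distribʳ v (b ⊠ quot)))) ⟩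
      u ⊠ b ⊞ (v ⊠ a ⊞ ⊟ (v ⊠ (b ⊠ quot)))    ≈⟨ ⊞-congˡ (u ⊠ b) (⊞-congˡ (v ⊠ a) (⊟-cong (PS.solve 3
                                                   (λ x y z → (x PS.⊗ (y PS.⊗ z)) PS.⊜ ((x PS.⊗ z) PS.⊗ y)) ≈-refl v b quot))) ⟩
      u ⊠ b ⊞ (v ⊠ a ⊞ ⊟ ((v ⊠ quot) ⊠ b))    ≈⟨ ⊞-congˡ (u ⊠ b) (⊞-congˡ (v ⊠ a) (⊟-distribˡ (v ⊠ quot) b)) ⟩
      u ⊠ b ⊞ (v ⊠ a ⊞ ⊟ (v ⊠ quot) ⊠ b)      ≈⟨ PS.solve 4 (λ x y z w → (x PS.⊗ y PS.⊕ (z PS.⊕ w PS.⊗ y)) PS.⊜ (z PS.⊕ (x PS.⊕ w) PS.⊗ y))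
                                                   ≈-refl u b (v ⊠ a) (⊟ (v ⊠ quot)) ⟩
      v ⊠ a ⊞ (u ⊞ ⊟ (v ⊠ quot)) ⊠ b          ∎
      where open ≈-Reasoning
    g[cq+d]≈a : g ⊠ (c ⊠ quot ⊞ d) ≈ a
    g[cq+d]≈a = begin
      g ⊠ (c ⊠ quot ⊞ d)          ≈⟨ ⊠-distribˡ g _ d ⟩
      g ⊠ (c ⊠ quot) ⊞ g ⊠ d      ≈⟨ ⊞-congʳ (g ⊠ d) (≈-sym (⊠-assoc g c quot)) ⟩
      (g ⊠ c) ⊠ quot ⊞ g ⊠ d      ≈⟨ ⊞-cong (⊠-congʳ quot (proj₂ g∣a)) (proj₂ g∣b) ⟩
      b ⊠ quot ⊞ r                ≈⟨ ≈-sym a≈bq+r ⟩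
      a                           ∎
      where open ≈-Reasoning

  module Irreducibility (h : Poly F) (m : ℕ) (deg-h : Deg F h m) (irr : Irreducible F h) where

    -- g = gcd(h, p) divides h, so either g is a unit (and p is coprime to h) or g is an associate of h.
    ∣ₚ⊎coprime : ∀ p → h ∣ₚ p ⊎ (Σ (Poly F) λ u → Σ (Poly F) λ v → u ⊠ p ⊞ v ⊠ h ≈ (1# ∷ []))
    ∣ₚ⊎coprime p = dichotomy (proj₂ irr g c (at (≈-sym (proj₂ g∣b))))
      where
      open Bezout (bezout (suc m) ℕₚ.≤-refl h deg-h p)
      open ≈-Reasoning
      c = proj₁ g∣b
      d = proj₁ g∣a
      dichotomy : Deg F g 0 ⊎ Deg F c 0 → h ∣ₚ p ⊎ (Σ (Poly F) λ u → Σ (Poly F) λ v → u ⊠ p ⊞ v ⊠ h ≈ (1# ∷ []))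
      dichotomy (inj₁ deg-g≡0) = inj₂ (scale g₀⁻¹ u , scale g₀⁻¹ v , (begin
        scale g₀⁻¹ u ⊠ p ⊞ scale g₀⁻¹ v ⊠ h    ≈⟨ ⊞-cong (scale-⊠ g₀⁻¹ u p) (scale-⊠ g₀⁻¹ v h) ⟩
        scale g₀⁻¹ (u ⊠ p) ⊞ scale g₀⁻¹ (v ⊠ h) ≈⟨ ≈-sym (scale-⊞ g₀⁻¹ (u ⊠ p) (v ⊠ h)) ⟩
        scale g₀⁻¹ (u ⊠ p ⊞ v ⊠ h)             ≈⟨ scale-cong g₀⁻¹ (≈-sym g≈ua+vb) ⟩
        scale g₀⁻¹ g                           ≈⟨ scale-cong g₀⁻¹ (Deg0⇒const g deg-g≡0) ⟩
        (g₀⁻¹ * cf g 0 ∷ [])                   ≈⟨ ∷-cong (*-inverseˡ (cf g 0) (proj₁ deg-g≡0)) ≈-refl ⟩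
        (1# ∷ [])                              ∎))
        where g₀⁻¹ = inv (cf g 0) (proj₁ deg-g≡0)
      dichotomy (inj₂ deg-c≡0) = inj₁ (scale c₀⁻¹ d , (begin
        h ⊠ scale c₀⁻¹ d              ≈⟨ ⊠-scale c₀⁻¹ h d ⟩
        scale c₀⁻¹ (h ⊠ d)            ≈⟨ scale-cong c₀⁻¹ (⊠-congʳ d (≈-sym c₀g≈h)) ⟩
        scale c₀⁻¹ (scale c₀ g ⊠ d)   ≈⟨ scale-cong c₀⁻¹ (scale-⊠ c₀ g d) ⟩
        scale c₀⁻¹ (scale c₀ (g ⊠ d)) ≈⟨ scale-inv-cancel c₀ _ (proj₁ deg-c≡0) ⟩
        g ⊠ d                         ≈⟨ proj₂ g∣a ⟩
        p                             ∎))
        where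
        c₀ = cf c 0
        c₀⁻¹ = inv c₀ (proj₁ deg-c≡0)
        c₀g≈h : scale c₀ g ≈ h
        c₀g≈h = ≈-trans (≈-sym (⊠-const g c₀)) (≈-trans (⊠-congˡ g (≈-sym (Deg0⇒const c deg-c≡0))) (proj₂ g∣b))

module CyclicAlgebra {q : ℕ} (F : FiniteField q) where
  open PolynomialDivision F public
  open ≡-Reasoning

  A : ℕ → Set
  A n = Vec Carrier n

  infixl 6 _⊕_
  _⊕_ : ∀ {n} → A n → A n → A n
  _⊕_ = addA F
  infixr 7 _·_
  _·_ : ∀ {n} → Carrier → A n → A n
  _·_ = scaleA F
  𝟘 : ∀ {n} → A n
  𝟘 = zeroA F
  rot : ∀ {n} → A n → A n
  rot = mulX F
  rot^ : ∀ {n} → ℕ → A n → A n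
  rot^ = mulXPow F

  ⊕-assoc : ∀ {n} (u v w : A n) → (u ⊕ v) ⊕ w ≡ u ⊕ (v ⊕ w)
  ⊕-assoc [] [] [] = refl
  ⊕-assoc (a ∷ u) (b ∷ v) (c ∷ w) = cong₂ _∷_ (+-assoc a b c) (⊕-assoc u v w)

  ⊕-comm : ∀ {n} (u v : A n) → u ⊕ v ≡ v ⊕ u
  ⊕-comm [] [] = refl
  ⊕-comm (a ∷ u) (b ∷ v) = cong₂ _∷_ (+-comm a b) (⊕-comm u v)

  ⊕-identityˡ : ∀ {n} (u : A n) → 𝟘 ⊕ u ≡ u
  ⊕-identityˡ [] = refl
  ⊕-identityˡ (a ∷ u) = cong₂ _∷_ (+-identityˡ a) (⊕-identityˡ u)

  ⊕-identityʳ : ∀ {n} (u : A n) → u ⊕ 𝟘 ≡ u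
  ⊕-identityʳ u = trans (⊕-comm u 𝟘) (⊕-identityˡ u)

  ·-distribʳ : ∀ {n} a b (u : A n) → (a + b) · u ≡ a · u ⊕ b · u
  ·-distribʳ a b [] = refl
  ·-distribʳ a b (c ∷ u) = cong₂ _∷_ (distribʳ c a b) (·-distribʳ a b u)

  ·-distribˡ : ∀ {n} a (u v : A n) → a · (u ⊕ v) ≡ a · u ⊕ a · v
  ·-distribˡ a [] [] = refl
  ·-distribˡ a (b ∷ u) (c ∷ v) = cong₂ _∷_ (distribˡ a b c) (·-distribˡ a u v)

  ·-assoc : ∀ {n} a b (u : A n) → (a * b) · u ≡ a · (b · u)
  ·-assoc a b [] = refl
  ·-assoc a b (c ∷ u) = cong₂ _∷_ (*-assoc a b c) (·-assoc a b u)

  ·-comm : ∀ {n} a c (u : A n) → a · (c · u) ≡ c · (a · u)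
  ·-comm a c u = trans (sym (·-assoc a c u)) (trans (cong (_· u) (*-comm a c)) (·-assoc c a u))

  ·-identityˡ : ∀ {n} (u : A n) → 1# · u ≡ u
  ·-identityˡ [] = refl
  ·-identityˡ (c ∷ u) = cong₂ _∷_ (*-identityˡ c) (·-identityˡ u)

  ·-zeroˡ : ∀ {n} (u : A n) → 0# · u ≡ 𝟘
  ·-zeroˡ [] = refl
  ·-zeroˡ (c ∷ u) = cong₂ _∷_ (*-zeroˡ c) (·-zeroˡ u)

  ·-zeroʳ : ∀ {n} a → a · 𝟘 {n} ≡ 𝟘
  ·-zeroʳ {zero} a = refl
  ·-zeroʳ {suc n} a = cong₂ _∷_ (*-zeroʳ a) (·-zeroʳ a)

  ⊕-interchange : ∀ {n} (u v w x : A n) → (u ⊕ v) ⊕ (w ⊕ x) ≡ (u ⊕ w) ⊕ (v ⊕ x)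
  ⊕-interchange [] [] [] [] = refl
  ⊕-interchange (a ∷ u) (b ∷ v) (c ∷ w) (d ∷ x) = cong₂ _∷_ (+-interchange a b c d) (⊕-interchange u v w x)

  ·-inverseʳ : ∀ {n} β (u : A n) → β · u ⊕ (- β) · u ≡ 𝟘
  ·-inverseʳ β u = begin
    β · u ⊕ (- β) · u  ≡⟨ sym (·-distribʳ β (- β) u) ⟩
    (β + - β) · u      ≡⟨ cong (_· u) (-‿inverseʳ β) ⟩
    0# · u             ≡⟨ ·-zeroˡ u ⟩
    𝟘                  ∎

  u⊕[-β]v≡𝟘⇒u≡βv : ∀ {n} β (u v : A n) → u ⊕ (- β) · v ≡ 𝟘 → u ≡ β · v
  u⊕[-β]v≡𝟘⇒u≡βv β u v u-βv≡𝟘 = begin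
    u                          ≡⟨ sym (⊕-identityʳ u) ⟩
    u ⊕ 𝟘                      ≡⟨ cong (u ⊕_) (sym (trans (⊕-comm _ _) (·-inverseʳ β v))) ⟩
    u ⊕ ((- β) · v ⊕ β · v)    ≡⟨ sym (⊕-assoc u _ _) ⟩
    (u ⊕ (- β) · v) ⊕ β · v    ≡⟨ cong (_⊕ β · v) u-βv≡𝟘 ⟩
    𝟘 ⊕ β · v                  ≡⟨ ⊕-identityˡ _ ⟩
    β · v                      ∎

  ⊕-∷ʳ : ∀ {n} (u v : A n) a b → (u ∷ʳ a) ⊕ (v ∷ʳ b) ≡ (u ⊕ v) ∷ʳ (a + b)
  ⊕-∷ʳ [] [] a b = refl
  ⊕-∷ʳ (c ∷ u) (d ∷ v) a b = cong ((c + d) ∷_) (⊕-∷ʳ u v a b)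

  ·-∷ʳ : ∀ {n} c (u : A n) a → c · (u ∷ʳ a) ≡ (c · u) ∷ʳ (c * a)
  ·-∷ʳ c [] a = refl
  ·-∷ʳ c (d ∷ u) a = cong ((c * d) ∷_) (·-∷ʳ c u a)

  rot-∷ʳ : ∀ {n} (u : A n) a → rot (u ∷ʳ a) ≡ a ∷ u
  rot-∷ʳ u a = cong₂ _∷_ (Vecₚ.last-∷ʳ a u) (Vecₚ.init-∷ʳ a u)

  init∷ʳlast : ∀ {n} (u : A (suc n)) → u ≡ Vec.init u ∷ʳ Vec.last u
  init∷ʳlast u = proj₂ (proj₂ (Vec.initLast u))

  rot-⊕ : ∀ {n} (u v : A n) → rot (u ⊕ v) ≡ rot u ⊕ rot v
  rot-⊕ {zero} u v = refl
  rot-⊕ {suc n} u v = begin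
    rot (u ⊕ v) ≡⟨ cong₂ (λ x y → rot (x ⊕ y)) (init∷ʳlast u) (init∷ʳlast v) ⟩
    rot ((Vec.init u ∷ʳ Vec.last u) ⊕ (Vec.init v ∷ʳ Vec.last v)) ≡⟨ cong rot (⊕-∷ʳ (Vec.init u) (Vec.init v) _ _) ⟩
    rot ((Vec.init u ⊕ Vec.init v) ∷ʳ (Vec.last u + Vec.last v)) ≡⟨ rot-∷ʳ _ _ ⟩
    (Vec.last u + Vec.last v) ∷ (Vec.init u ⊕ Vec.init v) ≡⟨⟩
    rot u ⊕ rot v ∎

  rot-· : ∀ {n} c (u : A n) → rot (c · u) ≡ c · rot u
  rot-· {zero} c u = refl
  rot-· {suc n} c u = begin
    rot (c · u) ≡⟨ cong (λ x → rot (c · x)) (init∷ʳlast u) ⟩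
    rot (c · (Vec.init u ∷ʳ Vec.last u)) ≡⟨ cong rot (·-∷ʳ c (Vec.init u) _) ⟩
    rot ((c · Vec.init u) ∷ʳ (c * Vec.last u)) ≡⟨ rot-∷ʳ _ _ ⟩
    c · rot u ∎

  rot-injective : ∀ {n} (u v : A n) → rot u ≡ rot v → u ≡ v
  rot-injective {zero} u v e = e
  rot-injective {suc n} u v e = begin
    u ≡⟨ init∷ʳlast u ⟩
    Vec.init u ∷ʳ Vec.last u ≡⟨ cong₂ (λ x y → x ∷ʳ y) (Vecₚ.∷-injectiveʳ e) (Vecₚ.∷-injectiveˡ e) ⟩
    Vec.init v ∷ʳ Vec.last v ≡⟨ sym (init∷ʳlast v) ⟩
    v ∎

  record Linear {n} (S : A n → A n) : Set where
    field
      map-⊕ : ∀ u v → S (u ⊕ v) ≡ S u ⊕ S v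
      map-· : ∀ c u → S (c · u) ≡ c · S u
    map-𝟘 : S 𝟘 ≡ 𝟘
    map-𝟘 = begin
      S 𝟘 ≡⟨ cong S (sym (·-zeroˡ 𝟘)) ⟩
      S (0# · 𝟘) ≡⟨ map-· 0# 𝟘 ⟩
      0# · S 𝟘 ≡⟨ ·-zeroˡ _ ⟩
      𝟘 ∎
  open Linear public

  rot-linear : ∀ {n} → Linear (rot {n})
  rot-linear = record { map-⊕ = rot-⊕ ; map-· = rot-· }

  rot^-linear : ∀ {n} j → Linear (rot^ {n} j)
  rot^-linear zero = record { map-⊕ = λ u v → refl ; map-· = λ c u → refl }
  rot^-linear (suc j) = record
    { map-⊕ = λ u v → trans (cong rot (map-⊕ (rot^-linear j) u v)) (rot-⊕ _ _)
    ; map-· = λ c u → trans (cong rot (map-· (rot^-linear j) c u)) (rot-· c _) }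

  rot^-rot : ∀ {n} j (u : A n) → rot^ j (rot u) ≡ rot (rot^ j u)
  rot^-rot zero u = refl
  rot^-rot (suc j) u = cong rot (rot^-rot j u)

  rot^-+ : ∀ {n} i j (u : A n) → rot^ (i ℕ.+ j) u ≡ rot^ i (rot^ j u)
  rot^-+ zero j u = refl
  rot^-+ (suc i) j u = cong rot (rot^-+ i j u)

  rot^-comm : ∀ {n} i j (u : A n) → rot^ i (rot^ j u) ≡ rot^ j (rot^ i u)
  rot^-comm i j u = trans (sym (rot^-+ i j u)) (trans (cong (λ k → rot^ k u) (ℕₚ.+-comm i j)) (rot^-+ j i u))

  rot^-injective : ∀ {n} j (u v : A n) → rot^ j u ≡ rot^ j v → u ≡ v
  rot^-injective zero u v e = e
  rot^-injective (suc j) u v e = rot^-injective j u v (rot-injective _ _ e)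

  iterate-rot : ∀ {n} (u : A n) e → iterate rot u e ≡ rot^ e u
  iterate-rot u zero    = refl
  iterate-rot u (suc e) = trans (iterate-rot (rot u) e) (rot^-rot e u)

  iterate-rot^ : ∀ {n} t (u : A n) k → iterate (rot^ t) u k ≡ rot^ (k ℕ.* t) u
  iterate-rot^ t u zero    = refl
  iterate-rot^ t u (suc k) = begin
    iterate (rot^ t) (rot^ t u) k  ≡⟨ iterate-rot^ t (rot^ t u) k ⟩
    rot^ (k ℕ.* t) (rot^ t u)      ≡⟨ sym (rot^-+ (k ℕ.* t) t u) ⟩
    rot^ (k ℕ.* t ℕ.+ t) u         ≡⟨ cong (λ e → rot^ e u) (ℕₚ.+-comm (k ℕ.* t) t) ⟩
    rot^ (t ℕ.+ k ℕ.* t) u         ∎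

  act : ∀ {n} (S : A n → A n) → Poly F → A n → A n
  act S [] w = 𝟘
  act S (c ∷ p) w = c · w ⊕ act S p (S w)

  polyMulA≡act : ∀ {n} p (w : A n) → polyMulA F p w ≡ act rot p w
  polyMulA≡act [] w = refl
  polyMulA≡act (c ∷ p) w = cong (c · w ⊕_) (polyMulA≡act p (rot w))

  _≟ᵥ_ : ∀ {n} → DecidableEquality (A n)
  _≟ᵥ_ = Vecₚ.≡-dec _≟_

  ⊕-commutativeMonoid : ℕ → CommutativeMonoid 0ℓ 0ℓ
  ⊕-commutativeMonoid n = record
    { Carrier = A n ; _≈_ = _≡_ ; _∙_ = _⊕_ ; ε = 𝟘
    ; isCommutativeMonoid = record
      { isMonoid = record
        { isSemigroup = record
          { isMagma = record { isEquivalence = isEquivalence ; ∙-cong = cong₂ _⊕_ }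
          ; assoc = ⊕-assoc }
        ; identity = ⊕-identityˡ , ⊕-identityʳ }
      ; comm = ⊕-comm } }

  module Action {n} (S : A n → A n) (S-linear : Linear S) where
    private module CM = Algebra.Solver.CommutativeMonoid (⊕-commutativeMonoid n)

    act-⊞ : ∀ p p' (w : A n) → act S (p ⊞ p') w ≡ act S p w ⊕ act S p' w
    act-⊞ [] p' w = sym (⊕-identityˡ _)
    act-⊞ (a ∷ p) [] w = sym (⊕-identityʳ _)
    act-⊞ (a ∷ p) (b ∷ p') w = begin
      (a + b) · w ⊕ act S (p ⊞ p') (S w) ≡⟨ cong₂ _⊕_ (·-distribʳ a b w) (act-⊞ p p' (S w)) ⟩
      (a · w ⊕ b · w) ⊕ (act S p (S w) ⊕ act S p' (S w)) ≡⟨ ⊕-interchange _ _ _ _ ⟩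
      (a · w ⊕ act S p (S w)) ⊕ (b · w ⊕ act S p' (S w)) ∎

    act-⊕ : ∀ p (u v : A n) → act S p (u ⊕ v) ≡ act S p u ⊕ act S p v
    act-⊕ [] u v = sym (⊕-identityˡ _)
    act-⊕ (a ∷ p) u v = begin
      a · (u ⊕ v) ⊕ act S p (S (u ⊕ v))
        ≡⟨ cong₂ _⊕_ (·-distribˡ a u v) (trans (cong (act S p) (map-⊕ S-linear u v)) (act-⊕ p (S u) (S v))) ⟩
      (a · u ⊕ a · v) ⊕ (act S p (S u) ⊕ act S p (S v)) ≡⟨ ⊕-interchange _ _ _ _ ⟩
      (a · u ⊕ act S p (S u)) ⊕ (a · v ⊕ act S p (S v)) ∎

    act-· : ∀ p c (u : A n) → act S p (c · u) ≡ c · act S p u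
    act-· [] c u = sym (·-zeroʳ c)
    act-· (a ∷ p) c u = begin
      a · (c · u) ⊕ act S p (S (c · u))
        ≡⟨ cong₂ _⊕_ (·-comm a c u) (trans (cong (act S p) (map-· S-linear c u)) (act-· p c (S u))) ⟩
      c · (a · u) ⊕ c · act S p (S u) ≡⟨ sym (·-distribˡ c _ _) ⟩
      c · (a · u ⊕ act S p (S u)) ∎

    act-linear : ∀ p → Linear (act S p)
    act-linear p = record { map-⊕ = act-⊕ p ; map-· = act-· p }

    act-𝟘 : ∀ p → act S p 𝟘 ≡ 𝟘
    act-𝟘 p = map-𝟘 (act-linear p)

    act-scale : ∀ a p (w : A n) → act S (scale a p) w ≡ a · act S p w
    act-scale a [] w = sym (·-zeroʳ a)
    act-scale a (b ∷ p) w = begin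
      (a * b) · w ⊕ act S (scale a p) (S w) ≡⟨ cong₂ _⊕_ (·-assoc a b w) (act-scale a p (S w)) ⟩
      a · (b · w) ⊕ a · act S p (S w) ≡⟨ sym (·-distribˡ a _ _) ⟩
      a · (b · w ⊕ act S p (S w)) ∎

    act-commute : ∀ (T : A n → A n) → Linear T → (∀ u → T (S u) ≡ S (T u)) →
                ∀ p (w : A n) → act S p (T w) ≡ T (act S p w)
    act-commute T T-linear c [] w = sym (map-𝟘 T-linear)
    act-commute T T-linear c (a ∷ p) w = begin
      a · T w ⊕ act S p (S (T w))
        ≡⟨ cong₂ _⊕_ (sym (map-· T-linear a w)) (trans (cong (act S p) (sym (c w))) (act-commute T T-linear c p (S w))) ⟩
      T (a · w) ⊕ T (act S p (S w)) ≡⟨ sym (map-⊕ T-linear _ _) ⟩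
      T (a · w ⊕ act S p (S w)) ∎

    act-comm : ∀ p (w : A n) → act S p (S w) ≡ S (act S p w)
    act-comm = act-commute S S-linear (λ u → refl)

    act-⊠ : ∀ p p' (w : A n) → act S (p ⊠ p') w ≡ act S p (act S p' w)
    act-⊠ [] p' w = refl
    act-⊠ (a ∷ p) p' w = begin
      act S (scale a p' ⊞ (0# ∷ p ⊠ p')) w ≡⟨ act-⊞ (scale a p') (0# ∷ p ⊠ p') w ⟩
      act S (scale a p') w ⊕ (0# · w ⊕ act S (p ⊠ p') (S w))
        ≡⟨ cong₂ _⊕_ (act-scale a p' w) (cong₂ _⊕_ (·-zeroˡ w) (act-⊠ p p' (S w))) ⟩
      a · act S p' w ⊕ (𝟘 ⊕ act S p (act S p' (S w)))
        ≡⟨ cong (a · act S p' w ⊕_) (trans (⊕-identityˡ _) (cong (act S p) (act-comm p' w))) ⟩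
      a · act S p' w ⊕ act S p (S (act S p' w)) ∎

    act-≈[] : ∀ p (w : A n) → p ≈ [] → act S p w ≡ 𝟘
    act-≈[] [] w e = refl
    act-≈[] (a ∷ p) w e = begin
      a · w ⊕ act S p (S w) ≡⟨ cong₂ _⊕_ (trans (cong (_· w) (at e zero)) (·-zeroˡ w)) (act-≈[] p (S w) (tail-≈[] e)) ⟩
      𝟘 ⊕ 𝟘 ≡⟨ ⊕-identityˡ _ ⟩
      𝟘 ∎

    act-cong : ∀ {p p'} (w : A n) → p ≈ p' → act S p w ≡ act S p' w
    act-cong {[]} {p'} w e = sym (act-≈[] p' w (≈-sym e))
    act-cong {a ∷ p} {[]} w e = act-≈[] (a ∷ p) w e
    act-cong {a ∷ p} {b ∷ p'} w e = cong₂ _⊕_ (cong (_· w) (at e zero)) (act-cong (S w) (tail-≈ e))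

    act-1 : ∀ (w : A n) → act S (1# ∷ []) w ≡ w
    act-1 w = trans (⊕-identityʳ _) (·-identityˡ w)

    act-const : ∀ c (w : A n) → act S (c ∷ []) w ≡ c · w
    act-const c w = ⊕-identityʳ _

    act-X^ : ∀ e (w : A n) → act S (X^ e) w ≡ iterate S w e
    act-X^ zero    w = act-1 w
    act-X^ (suc e) w = begin
      0# · w ⊕ act S (X^ e) (S w)  ≡⟨ cong (_⊕ act S (X^ e) (S w)) (·-zeroˡ w) ⟩
      𝟘 ⊕ act S (X^ e) (S w)       ≡⟨ ⊕-identityˡ _ ⟩
      act S (X^ e) (S w)           ≡⟨ act-X^ e (S w) ⟩
      iterate S (S w) e            ∎

    act-X^− : ∀ e β (w : A n) → act S (X^ e − β) w ≡ iterate S w e ⊕ (- β) · w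
    act-X^− e β w = trans (act-⊞ (X^ e) _ w) (cong₂ _⊕_ (act-X^ e w) (act-const (- β) w))

    act-synthDiv : ∀ β p w → act S p w ≡ (S (act S (synthDiv β p) w) ⊕ (- β) · act S (synthDiv β p) w) ⊕ eval p β · w
    act-synthDiv β [] w = sym (begin
      (S 𝟘 ⊕ (- β) · 𝟘) ⊕ 0# · w   ≡⟨ cong₂ (λ x y → (x ⊕ y) ⊕ 0# · w) (map-𝟘 S-linear) (·-zeroʳ (- β)) ⟩
      (𝟘 ⊕ 𝟘) ⊕ 0# · w             ≡⟨ cong₂ _⊕_ (⊕-identityˡ 𝟘) (·-zeroˡ w) ⟩
      𝟘 ⊕ 𝟘                        ≡⟨ ⊕-identityˡ 𝟘 ⟩
      𝟘                            ∎)
    act-synthDiv β (c ∷ p) w = begin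
      c · w ⊕ act S p (S w)
        ≡⟨ cong (c · w ⊕_) (act-synthDiv β p (S w)) ⟩
      c · w ⊕ ((S Y ⊕ (- β) · Y) ⊕ r · S w)
        ≡⟨ sym (⊕-identityʳ _) ⟩
      (c · w ⊕ ((S Y ⊕ (- β) · Y) ⊕ r · S w)) ⊕ 𝟘
        ≡⟨ cong ((c · w ⊕ ((S Y ⊕ (- β) · Y) ⊕ r · S w)) ⊕_) (sym -βr+βr≡𝟘) ⟩
      (c · w ⊕ ((S Y ⊕ (- β) · Y) ⊕ r · S w)) ⊕ ((- β) · (r · w) ⊕ (β * r) · w)
        ≡⟨ CM.solve 6 (λ a b c d e f → ((e CM.⊕ ((b CM.⊕ d) CM.⊕ a)) CM.⊕ (c CM.⊕ f))
                                       CM.⊜ (((a CM.⊕ b) CM.⊕ (c CM.⊕ d)) CM.⊕ (e CM.⊕ f)))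
             refl (r · S w) (S Y) ((- β) · (r · w)) ((- β) · Y) (c · w) ((β * r) · w) ⟩
      ((r · S w ⊕ S Y) ⊕ ((- β) · (r · w) ⊕ (- β) · Y)) ⊕ (c · w ⊕ (β * r) · w)
        ≡⟨ cong₂ (λ x y → (x ⊕ y) ⊕ (c · w ⊕ (β * r) · w)) (sym S[rw⊕Y]) (sym (·-distribˡ (- β) (r · w) Y)) ⟩
      (S (r · w ⊕ Y) ⊕ (- β) · (r · w ⊕ Y)) ⊕ (c · w ⊕ (β * r) · w)
        ≡⟨ cong ((S (r · w ⊕ Y) ⊕ (- β) · (r · w ⊕ Y)) ⊕_) (sym (·-distribʳ c (β * r) w)) ⟩
      (S (r · w ⊕ Y) ⊕ (- β) · (r · w ⊕ Y)) ⊕ (c + β * r) · w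
        ∎
      where
      Y = act S (synthDiv β p) (S w)
      r = eval p β
      S[rw⊕Y] : S (r · w ⊕ Y) ≡ r · S w ⊕ S Y
      S[rw⊕Y] = trans (map-⊕ S-linear _ _) (cong (_⊕ S Y) (map-· S-linear r w))
      -βr+βr≡𝟘 : (- β) · (r · w) ⊕ (β * r) · w ≡ 𝟘
      -βr+βr≡𝟘 = begin
        (- β) · (r · w) ⊕ (β * r) · w   ≡⟨ cong (_⊕ (β * r) · w) (sym (·-assoc (- β) r w)) ⟩
        (- β * r) · w ⊕ (β * r) · w     ≡⟨ sym (·-distribʳ _ _ w) ⟩
        (- β * r + β * r) · w           ≡⟨ cong (_· w) (sym (distribʳ r (- β) β)) ⟩
        ((- β + β) * r) · w             ≡⟨ cong (λ x → (x * r) · w) (-‿inverseˡ β) ⟩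
        (0# * r) · w                    ≡⟨ cong (_· w) (*-zeroˡ r) ⟩
        0# · w                          ≡⟨ ·-zeroˡ w ⟩
        𝟘                               ∎

  module SplitAnnihilator {n} (S : A n → A n) (S-linear : Linear S) (z : A n) (z≢0 : z ≢ 𝟘)
    (eigen-transfer : ∀ p β → act S p z ≢ 𝟘 → S (act S p z) ≡ β · act S p z → S z ≡ β · z) where
    open Action S S-linear

    roots-synthDiv : ∀ β p → eval p β ≡ 0# → ∀ βs → All (λ b → eval p b ≡ 0#) βs → All (β ≢_) βs →
                  All (λ b → eval (synthDiv β p) b ≡ 0#) βs
    roots-synthDiv β p pβ≡0 []       []          []          = []
    roots-synthDiv β p pβ≡0 (b ∷ bs) (pb≡0 ∷ rs) (β≢b ∷ ds) =
      x≢0∧x*y≡0⇒y≡0 (x-y≢0 β≢b) [b-β]q≡0 ∷ roots-synthDiv β p pβ≡0 bs rs ds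
      where
      [b-β]q≡0 : (b + - β) * eval (synthDiv β p) b ≡ 0#
      [b-β]q≡0 = begin
        (b + - β) * eval (synthDiv β p) b           ≡⟨ sym (+-identityʳ _) ⟩
        (b + - β) * eval (synthDiv β p) b + 0#      ≡⟨ cong ((b + - β) * eval (synthDiv β p) b +_) (sym pβ≡0) ⟩
        (b + - β) * eval (synthDiv β p) b + eval p β ≡⟨ sym (eval-synthDiv β p b) ⟩
        eval p b                                 ≡⟨ pb≡0 ⟩
        0#                                       ∎

    -- Strip the factors X - β off p one at a time: the first partial quotient that does not kill z is an eigenvector.
    eigenvector : ∀ βs p → Monic p (List.length βs) → All (λ b → eval p b ≡ 0#) βs →
                  AllPairs _≢_ βs → All (_≢ 0#) βs → act S p z ≡ 𝟘 →
                  Σ Carrier λ β → β ≢ 0# × S z ≡ β · z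
    eigenvector [] p p-monic _ _ _ pz≡0 = ⊥-elim (z≢0 (begin
      z                    ≡⟨ sym (act-1 z) ⟩
      act S (1# ∷ []) z    ≡⟨ act-cong z (≈-sym (Monic0⇒1 p p-monic)) ⟩
      act S p z            ≡⟨ pz≡0 ⟩
      𝟘                    ∎))
    eigenvector (β ∷ βs) p p-monic (pβ≡0 ∷ roots) (β∉βs ∷ distinct) (β≢0 ∷ nonzero) pz≡0
      with act S (synthDiv β p) z ≟ᵥ 𝟘
    ... | yes w≡0 = eigenvector βs (synthDiv β p) (Monic-synthDiv β p (List.length βs) p-monic)
                      (roots-synthDiv β p pβ≡0 βs roots β∉βs) distinct nonzero w≡0
    ... | no  w≢0 = β , β≢0 , eigen-transfer (synthDiv β p) β w≢0 (u⊕[-β]v≡𝟘⇒u≡βv β _ w Sw-βw≡0)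
      where
      w = act S (synthDiv β p) z
      Sw-βw≡0 : S w ⊕ (- β) · w ≡ 𝟘
      Sw-βw≡0 = begin
        S w ⊕ (- β) · w                       ≡⟨ sym (⊕-identityʳ _) ⟩
        (S w ⊕ (- β) · w) ⊕ 𝟘                 ≡⟨ cong ((S w ⊕ (- β) · w) ⊕_) (sym (trans (cong (_· z) pβ≡0) (·-zeroˡ z))) ⟩
        (S w ⊕ (- β) · w) ⊕ eval p β · z      ≡⟨ sym (act-synthDiv β p z) ⟩
        act S p z                             ≡⟨ pz≡0 ⟩
        𝟘                                     ∎

module ResidueRing {q : ℕ} (F : FiniteField q) (n m : ℕ) (h : Poly F)
                   (deg-h : Deg F h m) (irr : Irreducible F h) (ord : HasOrder F h n) where
  open PolynomialDivision F
  open Irreducibility h m deg-h irr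
  open import Algebra.Properties.CommutativeSemigroup
    (CommutativeMonoid.commutativeSemigroup (CommutativeRing.*-commutativeMonoid polyRing))
    using (x∙yz≈y∙xz; x∙yz≈z∙xy)

  infix 4 _≡ₕ_
  record _≡ₕ_ (a b : Poly F) : Set where
    constructor ≡ₕ-by
    field
      multiplier : Poly F
      ≈⊞h⊠ : a ≈ b ⊞ h ⊠ multiplier

  ≈⇒≡ₕ : ∀ {a b} → a ≈ b → a ≡ₕ b
  ≈⇒≡ₕ {a} {b} a≈b = ≡ₕ-by [] (≈-trans a≈b (≈-sym (≈-trans (⊞-congˡ b (⊠-zeroʳ h)) (⊞-identityʳ b))))

  ≡ₕ-refl : ∀ {a} → a ≡ₕ a
  ≡ₕ-refl = ≈⇒≡ₕ ≈-refl

  ≡ₕ-sym : ∀ {a b} → a ≡ₕ b → b ≡ₕ a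
  ≡ₕ-sym {a} {b} (≡ₕ-by c a≈b+hc) = ≡ₕ-by (⊟ c) (≈-sym (begin
    a ⊞ h ⊠ ⊟ c              ≈⟨ ⊞-congʳ (h ⊠ ⊟ c) a≈b+hc ⟩
    (b ⊞ h ⊠ c) ⊞ h ⊠ ⊟ c    ≈⟨ ⊞-assoc b _ _ ⟩
    b ⊞ (h ⊠ c ⊞ h ⊠ ⊟ c)    ≈⟨ ⊞-congˡ b (≈-sym (⊠-distribˡ h c (⊟ c))) ⟩
    b ⊞ h ⊠ (c ⊞ ⊟ c)        ≈⟨ ⊞-congˡ b (⊠-congˡ h (⊟-inverseʳ c)) ⟩
    b ⊞ h ⊠ []               ≈⟨ ⊞-congˡ b (⊠-zeroʳ h) ⟩
    b ⊞ []                   ≈⟨ ⊞-identityʳ b ⟩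
    b                        ∎))
    where open ≈-Reasoning

  ≡ₕ-trans : ∀ {a b c} → a ≡ₕ b → b ≡ₕ c → a ≡ₕ c
  ≡ₕ-trans {a} {b} {c} (≡ₕ-by d₁ a≈b+hd₁) (≡ₕ-by d₂ b≈c+hd₂) = ≡ₕ-by (d₂ ⊞ d₁) (begin
    a                          ≈⟨ a≈b+hd₁ ⟩
    b ⊞ h ⊠ d₁                 ≈⟨ ⊞-congʳ (h ⊠ d₁) b≈c+hd₂ ⟩
    (c ⊞ h ⊠ d₂) ⊞ h ⊠ d₁      ≈⟨ ⊞-assoc c _ _ ⟩
    c ⊞ (h ⊠ d₂ ⊞ h ⊠ d₁)      ≈⟨ ⊞-congˡ c (≈-sym (⊠-distribˡ h d₂ d₁)) ⟩
    c ⊞ h ⊠ (d₂ ⊞ d₁)          ∎)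
    where open ≈-Reasoning

  ⊠-congʳₕ : ∀ {a a′} b → a ≡ₕ a′ → a ⊠ b ≡ₕ a′ ⊠ b
  ⊠-congʳₕ {a} {a′} b (≡ₕ-by c a≈a′+hc) = ≡ₕ-by (c ⊠ b) (begin
    a ⊠ b                      ≈⟨ ⊠-congʳ b a≈a′+hc ⟩
    (a′ ⊞ h ⊠ c) ⊠ b           ≈⟨ ⊠-distribʳ a′ (h ⊠ c) b ⟩
    a′ ⊠ b ⊞ (h ⊠ c) ⊠ b       ≈⟨ ⊞-congˡ (a′ ⊠ b) (⊠-assoc h c b) ⟩
    a′ ⊠ b ⊞ h ⊠ (c ⊠ b)       ∎)
    where open ≈-Reasoning

  ⊠-congₕ : ∀ {a a′ b b′} → a ≡ₕ a′ → b ≡ₕ b′ → a ⊠ b ≡ₕ a′ ⊠ b′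
  ⊠-congₕ {a} {a′} {b} {b′} a≡a′ b≡b′ = ≡ₕ-trans (⊠-congʳₕ b a≡a′)
    (≡ₕ-trans (≈⇒≡ₕ (⊠-comm a′ b)) (≡ₕ-trans (⊠-congʳₕ a′ b≡b′) (≈⇒≡ₕ (⊠-comm b′ a′))))

  ⊠-commutativeMonoidₕ : CommutativeMonoid 0ℓ 0ℓ
  ⊠-commutativeMonoidₕ = record
    { Carrier = Poly F ; _≈_ = _≡ₕ_ ; _∙_ = _⊠_ ; ε = 1# ∷ []
    ; isCommutativeMonoid = record
      { isMonoid = record
        { isSemigroup = record
          { isMagma = record
            { isEquivalence = record { refl = ≡ₕ-refl ; sym = ≡ₕ-sym ; trans = ≡ₕ-trans }
            ; ∙-cong = ⊠-congₕ }
          ; assoc = λ a b c → ≈⇒≡ₕ (⊠-assoc a b c) }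
        ; identity = (λ a → ≈⇒≡ₕ (⊠-identityˡ a)) , (λ a → ≈⇒≡ₕ (≈-trans (⊠-comm a _) (⊠-identityˡ a))) }
      ; comm = λ a b → ≈⇒≡ₕ (⊠-comm a b) } }

  -- Two polynomials of degree below deg h that differ by h c must have c = 0, by comparing the coefficient at deg h + deg c.
  ≡ₕ⇒≈ : ∀ {a b} → DegreeBelow a m → DegreeBelow b m → a ≡ₕ b → a ≈ b
  ≡ₕ⇒≈ {a} {b} a<m b<m (≡ₕ-by c a≈b+hc) with ≈[]⊎Deg (List.length c) c (DegreeBelow-length c)
  ... | inj₁ c≈[] = ≈-trans a≈b+hc (≈-trans (⊞-congˡ b (≈-trans (⊠-congˡ h c≈[]) (⊠-zeroʳ h))) (⊞-identityʳ b))
  ... | inj₂ (k , _ , lc≢0 , c<k+1) = ⊥-elim (*-≢0 (proj₁ deg-h) lc≢0 (sym (begin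
      0#                                      ≡⟨ sym (a<m (m ℕ.+ k) (ℕₚ.m≤m+n m k)) ⟩
      cf a (m ℕ.+ k)                          ≡⟨ at a≈b+hc (m ℕ.+ k) ⟩
      cf (b ⊞ h ⊠ c) (m ℕ.+ k)                ≡⟨ cf-⊞ b (h ⊠ c) (m ℕ.+ k) ⟩
      cf b (m ℕ.+ k) + cf (h ⊠ c) (m ℕ.+ k)   ≡⟨ cong₂ _+_ (b<m (m ℕ.+ k) (ℕₚ.m≤m+n m k)) (cf-⊠-top h c m k (proj₂ deg-h) c<k+1) ⟩
      0# + cf h m * cf c k                    ≡⟨ +-identityˡ _ ⟩
      cf h m * cf c k                         ∎)))
    where open ≡-Reasoning

  Residue : Set
  Residue = Vec Carrier m

  reduce : Poly F → Residue
  reduce a = fromPoly m (proj₁ (proj₂ (divMod h deg-h a)))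

  reduce-≡ₕ : ∀ a → a ≡ₕ toPoly (reduce a)
  reduce-≡ₕ a with divMod h deg-h a
  ... | quot , r , a≈hq+r , r<m =
    ≡ₕ-by quot (≈-trans a≈hq+r (≈-trans (⊞-comm _ r) (⊞-congʳ (h ⊠ quot) (≈-sym (toPoly-fromPoly m r r<m)))))

  toPoly-injectiveₕ : ∀ (u v : Residue) → toPoly u ≡ₕ toPoly v → u ≡ v
  toPoly-injectiveₕ u v u≡ₕv = toPoly-injective u v (≡ₕ⇒≈ (toPoly-DegreeBelow u) (toPoly-DegreeBelow v) u≡ₕv)

  NonZeroₕ : Poly F → Set
  NonZeroₕ a = ¬ (a ≡ₕ [])

  -- A nonzero residue is coprime to the irreducible h, so u a + v h = 1 and u inverts a.
  ⊠-cancelʳₕ : ∀ a → NonZeroₕ a → ∀ x y → x ⊠ a ≡ₕ y ⊠ a → x ≡ₕ y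
  ⊠-cancelʳₕ a a≢0 x y xa≡ya with ∣ₚ⊎coprime a
  ... | inj₁ (c , hc≈a) = ⊥-elim (a≢0 (≡ₕ-by c (≈-sym hc≈a)))
  ... | inj₂ (u , v , ua+vh≈1) =
    ≡ₕ-trans (x≡u[xa] x) (≡ₕ-trans (⊠-congₕ (≡ₕ-refl {u}) xa≡ya) (≡ₕ-sym (x≡u[xa] y)))
    where
    x≡u[xa] : ∀ x → x ≡ₕ u ⊠ (x ⊠ a)
    x≡u[xa] x = ≡ₕ-by (x ⊠ v) (begin
      x                            ≈⟨ ≈-sym (≈-trans (⊠-comm x _) (⊠-identityˡ x)) ⟩
      x ⊠ (1# ∷ [])                ≈⟨ ⊠-congˡ x (≈-sym ua+vh≈1) ⟩
      x ⊠ (u ⊠ a ⊞ v ⊠ h)          ≈⟨ ⊠-distribˡ x (u ⊠ a) (v ⊠ h) ⟩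
      x ⊠ (u ⊠ a) ⊞ x ⊠ (v ⊠ h)    ≈⟨ ⊞-cong (x∙yz≈y∙xz x u a) (x∙yz≈z∙xy x v h) ⟩
      u ⊠ (x ⊠ a) ⊞ h ⊠ (x ⊠ v)    ∎)
      where open ≈-Reasoning

  ⊠-NonZeroₕ : ∀ {a b} → NonZeroₕ a → NonZeroₕ b → NonZeroₕ (a ⊠ b)
  ⊠-NonZeroₕ {a} {b} a≢0 b≢0 ab≡0 = a≢0 (⊠-cancelʳₕ b b≢0 a [] ab≡0)

  1≢ₕ0 : 1 ≤ m → NonZeroₕ (1# ∷ [])
  1≢ₕ0 1≤m 1≡0 = 1#≢0# (at (≡ₕ⇒≈ 1<m (λ _ _ → refl) 1≡0) 0)
    where
    1<m : DegreeBelow (1# ∷ []) m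
    1<m (suc i) _ = refl
    1<m zero    m≤0 with () ← ℕₚ.<-≤-trans 1≤m m≤0

  h∣X^−1⇒X^≡ₕ1 : ∀ {e} → h ∣ₚ (X^ e − 1#) → X^ e ≡ₕ (1# ∷ [])
  h∣X^−1⇒X^≡ₕ1 {e} (c , hc≈X^e−1) = ≡ₕ-by c (begin
    X^ e                               ≈⟨ ≈-sym (⊞-identityʳ (X^ e)) ⟩
    X^ e ⊞ []                          ≈⟨ ⊞-congˡ (X^ e) (≈-sym (⊟-inverseˡ (1# ∷ []))) ⟩
    X^ e ⊞ (((- 1#) ∷ []) ⊞ (1# ∷ [])) ≈⟨ ≈-sym (⊞-assoc (X^ e) _ _) ⟩
    (X^ e − 1#) ⊞ (1# ∷ [])            ≈⟨ ⊞-comm _ (1# ∷ []) ⟩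
    (1# ∷ []) ⊞ (X^ e − 1#)            ≈⟨ ⊞-congˡ (1# ∷ []) (≈-sym hc≈X^e−1) ⟩
    (1# ∷ []) ⊞ h ⊠ c                  ∎)
    where open ≈-Reasoning

  X^≡ₕ1⇒h∣X^−1 : ∀ {e} → X^ e ≡ₕ (1# ∷ []) → h ∣ₚ (X^ e − 1#)
  X^≡ₕ1⇒h∣X^−1 {e} (≡ₕ-by c X^e≈1+hc) = c , ⊞-move (X^ e) (1# ∷ []) (h ⊠ c) X^e≈1+hc

  X^n≡ₕ1 : X^ n ≡ₕ (1# ∷ [])
  X^n≡ₕ1 = h∣X^−1⇒X^≡ₕ1 (∣P⇒∣ₚ {h} {X^ n − 1#} (proj₁ (proj₂ ord)))

  X^[k*n]≡ₕ1 : ∀ k → X^ (k ℕ.* n) ≡ₕ (1# ∷ [])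
  X^[k*n]≡ₕ1 zero    = ≡ₕ-refl
  X^[k*n]≡ₕ1 (suc k) = ≡ₕ-trans (≈⇒≡ₕ (≈-sym (X^-+ n (k ℕ.* n))))
                         (≡ₕ-trans (⊠-congₕ X^n≡ₕ1 (X^[k*n]≡ₕ1 k)) (≈⇒≡ₕ (⊠-identityˡ _)))

  private instance
    n-nonZero : NonZero n
    n-nonZero = ℕ.>-nonZero (proj₁ ord)

  X^≡ₕ1⇒n∣ : ∀ e → X^ e ≡ₕ (1# ∷ []) → n ∣ e
  X^≡ₕ1⇒n∣ e X^e≡1 with e % n in e%n≡r
  ... | zero  = m%n≡0⇒n∣m e n e%n≡r
  ... | suc r = ⊥-elim (proj₂ (proj₂ ord) (suc r) (s≤s z≤n) r<n (∣ₚ⇒∣P {h} (X^≡ₕ1⇒h∣X^−1 {suc r} X^r≡1)))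
    where
    r<n : suc r < n
    r<n = subst (_< n) e%n≡r (m%n<n e n)
    X^r≡1 : X^ suc r ≡ₕ (1# ∷ [])
    X^r≡1 = begin
      X^ suc r                               ≈⟨ ≈⇒≡ₕ (≈-sym (≈-trans (⊠-comm (X^ suc r) _) (⊠-identityˡ _))) ⟩
      X^ suc r ⊠ (1# ∷ [])                   ≈⟨ ⊠-congₕ (≡ₕ-refl {X^ suc r}) (≡ₕ-sym (X^[k*n]≡ₕ1 (e / n))) ⟩
      X^ suc r ⊠ X^ ((e / n) ℕ.* n)          ≈⟨ ≈⇒≡ₕ (X^-+ (suc r) _) ⟩
      X^ (suc r ℕ.+ (e / n) ℕ.* n)           ≡⟨ cong (λ i → X^ (i ℕ.+ (e / n) ℕ.* n)) (sym e%n≡r) ⟩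
      X^ (e % n ℕ.+ (e / n) ℕ.* n)           ≡⟨ cong X^_ (sym (m≡m%n+[m/n]*n e n)) ⟩
      X^ e                                   ≈⟨ X^e≡1 ⟩
      (1# ∷ [])                              ∎
      where open Relation.Binary.Reasoning.Setoid (CommutativeMonoid.setoid ⊠-commutativeMonoidₕ)

  open import Algebra.Properties.CommutativeMonoid.Sum ⊠-commutativeMonoidₕ using () renaming (sum to product)
  open import Algebra.Definitions.RawMonoid (CommutativeMonoid.rawMonoid ⊠-commutativeMonoidₕ)
    using () renaming (_×_ to _×ₘ_)

  ×ₘ-X^1 : ∀ k → k ×ₘ X^ 1 ≈ X^ k
  ×ₘ-X^1 zero    = ≈-refl
  ×ₘ-X^1 (suc k) = ≈-trans (⊠-congˡ (X^ 1) (×ₘ-X^1 k)) (X^-+ 1 k)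

  X⁻¹ : Poly F
  X⁻¹ = X^ (n ∸ 1)

  X⊠X⁻¹≡ₕ1 : X^ 1 ⊠ X⁻¹ ≡ₕ (1# ∷ [])
  X⊠X⁻¹≡ₕ1 = ≡ₕ-trans (≈⇒≡ₕ (≈-trans (X^-+ 1 (n ∸ 1)) (≡⇒≈ (cong X^_ (ℕₚ.m+[n∸m]≡n (proj₁ ord))))))
                      X^n≡ₕ1

  X⁻¹⊠X≡ₕ1 : X⁻¹ ⊠ X^ 1 ≡ₕ (1# ∷ [])
  X⁻¹⊠X≡ₕ1 = ≡ₕ-trans (≈⇒≡ₕ (⊠-comm X⁻¹ (X^ 1))) X⊠X⁻¹≡ₕ1

  unit-NonZeroₕ : 1 ≤ m → ∀ {a b} → a ⊠ b ≡ₕ (1# ∷ []) → NonZeroₕ a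
  unit-NonZeroₕ 1≤m {a} {b} ab≡1 a≡0 = 1≢ₕ0 1≤m (≡ₕ-trans (≡ₕ-sym ab≡1) (⊠-congʳₕ b a≡0))

  product-NonZeroₕ : 1 ≤ m → ∀ {k} (f : Fin k → Poly F) → (∀ i → NonZeroₕ (f i)) → NonZeroₕ (product f)
  product-NonZeroₕ 1≤m {zero}  f f≢0 = 1≢ₕ0 1≤m
  product-NonZeroₕ 1≤m {suc k} f f≢0 = ⊠-NonZeroₕ (f≢0 Fin.zero) (product-NonZeroₕ 1≤m (f ∘ Fin.suc) (f≢0 ∘ Fin.suc))

  mulₕ : Poly F → Residue → Residue
  mulₕ a v = reduce (a ⊠ toPoly v)

  toPoly-mulₕ : ∀ a v → toPoly (mulₕ a v) ≡ₕ a ⊠ toPoly v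
  toPoly-mulₕ a v = ≡ₕ-sym (reduce-≡ₕ (a ⊠ toPoly v))

  mulₕ-inverse : ∀ {a b} → b ⊠ a ≡ₕ (1# ∷ []) → ∀ v → mulₕ b (mulₕ a v) ≡ v
  mulₕ-inverse {a} {b} ba≡1 v = toPoly-injectiveₕ _ _ (begin
    toPoly (mulₕ b (mulₕ a v))   ≈⟨ toPoly-mulₕ b _ ⟩
    b ⊠ toPoly (mulₕ a v)        ≈⟨ ⊠-congₕ (≡ₕ-refl {b}) (toPoly-mulₕ a v) ⟩
    b ⊠ (a ⊠ toPoly v)           ≈⟨ ≈⇒≡ₕ (≈-sym (⊠-assoc b a _)) ⟩
    (b ⊠ a) ⊠ toPoly v           ≈⟨ ⊠-congʳₕ _ ba≡1 ⟩
    (1# ∷ []) ⊠ toPoly v         ≈⟨ ≈⇒≡ₕ (⊠-identityˡ _) ⟩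
    toPoly v                     ∎)
    where open Relation.Binary.Reasoning.Setoid (CommutativeMonoid.setoid ⊠-commutativeMonoidₕ)

  zeros : Residue
  zeros = Vec.replicate m 0#

  toPoly-NonZeroₕ : ∀ {v} → v ≢ zeros → NonZeroₕ (toPoly v)
  toPoly-NonZeroₕ {v} v≢0 v≡0 = v≢0 (toPoly-injectiveₕ v zeros (≡ₕ-trans v≡0 (≈⇒≡ₕ (≈-sym (toPoly-zeros m)))))

  mulₕ-≢zeros : ∀ {a} → NonZeroₕ a → ∀ {v} → v ≢ zeros → mulₕ a v ≢ zeros
  mulₕ-≢zeros {a} a≢0 {v} v≢0 av≡0 = ⊠-NonZeroₕ a≢0 (toPoly-NonZeroₕ v≢0)
    (≡ₕ-trans (≡ₕ-sym (toPoly-mulₕ a v)) (subst (λ w → toPoly w ≡ₕ []) (sym av≡0) (≈⇒≡ₕ (toPoly-zeros m))))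

  module _ (1≤m : 1 ≤ m) where
    open Punctured (↔Fin-suc zeros (Vec↔Fin^ card m)) zeros

    multiplication-by-X : Bijection
    multiplication-by-X = record
      { fun = mulₕ (X^ 1) ; fun⁻¹ = mulₕ X⁻¹
      ; fun-≢ = mulₕ-≢zeros (unit-NonZeroₕ 1≤m {X^ 1} {X⁻¹} X⊠X⁻¹≡ₕ1)
      ; fun⁻¹-≢ = mulₕ-≢zeros (unit-NonZeroₕ 1≤m {X⁻¹} {X^ 1} X⁻¹⊠X≡ₕ1)
      ; fun∘fun⁻¹ = λ {v} _ → mulₕ-inverse {X⁻¹} {X^ 1} X⊠X⁻¹≡ₕ1 v
      ; fun⁻¹∘fun = λ {v} _ → mulₕ-inverse {X^ 1} {X⁻¹} X⁻¹⊠X≡ₕ1 v }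

    -- Multiplication by x permutes the nonzero residues, so their product Π satisfies Π ≡ x^(q^m - 1) Π.
    X^[q^m∸1]≡ₕ1 : X^ (q ℕ.^ m ∸ 1) ≡ₕ (1# ∷ [])
    X^[q^m∸1]≡ₕ1 = ⊠-cancelʳₕ Π (product-NonZeroₕ 1≤m _ (toPoly-NonZeroₕ ∘ enum-≢)) _ _ (begin
      X^ (q ℕ.^ m ∸ 1) ⊠ Π              ≈⟨ ≈⇒≡ₕ (⊠-congʳ Π (≈-sym (×ₘ-X^1 (q ℕ.^ m ∸ 1)))) ⟩
      ((q ℕ.^ m ∸ 1) ×ₘ X^ 1) ⊠ Π       ≈⟨ ≡ₕ-sym (sum-punctured-scaled ⊠-commutativeMonoidₕ toPoly (X^ 1) multiplication-by-X
                                                     (λ {v} _ → toPoly-mulₕ (X^ 1) v)) ⟩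
      Π                                 ≈⟨ ≈⇒≡ₕ (≈-sym (⊠-identityˡ Π)) ⟩
      (1# ∷ []) ⊠ Π                     ∎)
      where
      Π = product (toPoly ∘ enum)
      open Relation.Binary.Reasoning.Setoid (CommutativeMonoid.setoid ⊠-commutativeMonoidₕ)

    n∣q^m∸1 : n ∣ q ℕ.^ m ∸ 1
    n∣q^m∸1 = X^≡ₕ1⇒n∣ _ X^[q^m∸1]≡ₕ1

module MinimalIdeal {q : ℕ} (F : FiniteField q) (n m : ℕ) (h : Poly F)
                    (deg-h : Deg F h m) (irr : Irreducible F h) (ord : HasOrder F h n) where
  open CyclicAlgebra F public
  open Irreducibility h m deg-h irr public
  open ResidueRing F n m h deg-h irr ord using (X^≡ₕ1⇒n∣; h∣X^−1⇒X^≡ₕ1)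
  open ≡-Reasoning
  private module Rot = Action (rot {n}) rot-linear

  J : A n → Set
  J w = act rot h w ≡ 𝟘

  InJ⇒J : ∀ {w} → InJ F h w → J w
  InJ⇒J {w} hw≡0 = trans (sym (polyMulA≡act h w)) hw≡0

  -- Since h is irreducible, an annihilator p of w ≠ 0 coprime to h would give 1 = u p + v h, killing w.
  h∣annihilator : ∀ {w} → J w → w ≢ 𝟘 → ∀ p → act rot p w ≡ 𝟘 → h ∣ₚ p
  h∣annihilator {w} w∈J w≢0 p pw≡0 with ∣ₚ⊎coprime p
  ... | inj₁ h∣p = h∣p
  ... | inj₂ (u , v , up+vh≈1) = ⊥-elim (w≢0 (begin
      w                                              ≡⟨ sym (Rot.act-1 w) ⟩
      act rot (1# ∷ []) w                            ≡⟨ Rot.act-cong w (≈-sym up+vh≈1) ⟩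
      act rot (u ⊠ p ⊞ v ⊠ h) w                      ≡⟨ Rot.act-⊞ (u ⊠ p) (v ⊠ h) w ⟩
      act rot (u ⊠ p) w ⊕ act rot (v ⊠ h) w          ≡⟨ cong₂ _⊕_ (Rot.act-⊠ u p w) (Rot.act-⊠ v h w) ⟩
      act rot u (act rot p w) ⊕ act rot v (act rot h w) ≡⟨ cong₂ (λ x y → act rot u x ⊕ act rot v y) pw≡0 w∈J ⟩
      act rot u 𝟘 ⊕ act rot v 𝟘                      ≡⟨ cong₂ _⊕_ (Rot.act-𝟘 u) (Rot.act-𝟘 v) ⟩
      𝟘 ⊕ 𝟘                                          ≡⟨ ⊕-identityˡ _ ⟩
      𝟘                                              ∎))

  annihilates-J : ∀ {p} → h ∣ₚ p → ∀ {w} → J w → act rot p w ≡ 𝟘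
  annihilates-J {p} (c , hc≈p) {w} w∈J = begin
    act rot p w              ≡⟨ Rot.act-cong w (≈-sym (≈-trans (⊠-comm c h) hc≈p)) ⟩
    act rot (c ⊠ h) w        ≡⟨ Rot.act-⊠ c h w ⟩
    act rot c (act rot h w)  ≡⟨ cong (act rot c) w∈J ⟩
    act rot c 𝟘              ≡⟨ Rot.act-𝟘 c ⟩
    𝟘                        ∎

  annihilator-transfer : ∀ {w} → J w → w ≢ 𝟘 → ∀ p → act rot p w ≡ 𝟘 →
                         ∀ {w′} → J w′ → act rot p w′ ≡ 𝟘
  annihilator-transfer w∈J w≢0 p pw≡0 = annihilates-J (h∣annihilator w∈J w≢0 p pw≡0)

  J-closed : ∀ T → Linear T → (∀ u → T (rot u) ≡ rot (T u)) → ∀ {w} → J w → J (T w)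
  J-closed T T-linear T∘rot {w} w∈J = trans (Rot.act-commute T T-linear T∘rot h w) (trans (cong T w∈J) (map-𝟘 T-linear))

  act-rot-X^− : ∀ e β (w : A n) → act rot (X^ e − β) w ≡ rot^ e w ⊕ (- β) · w
  act-rot-X^− e β w = trans (Rot.act-X^− e β w) (cong (_⊕ (- β) · w) (iterate-rot w e))

  annihilated⇒rot^≡ : ∀ e β (w : A n) → act rot (X^ e − β) w ≡ 𝟘 → rot^ e w ≡ β · w
  annihilated⇒rot^≡ e β w ann = u⊕[-β]v≡𝟘⇒u≡βv β _ w (trans (sym (act-rot-X^− e β w)) ann)

  instance
    n-nonZero : NonZero n
    n-nonZero = ℕ.>-nonZero (proj₁ ord)

  rot^n : ∀ {w} → J w → rot^ n w ≡ w
  rot^n {w} w∈J = trans (annihilated⇒rot^≡ n 1# w (annihilates-J h∣X^n−1 w∈J)) (·-identityˡ w)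
    where
    h∣X^n−1 : h ∣ₚ (X^ n − 1#)
    h∣X^n−1 = ∣P⇒∣ₚ {h} (proj₁ (proj₂ ord))

  rot^-*n : ∀ k {w} → J w → rot^ (k ℕ.* n) w ≡ w
  rot^-*n zero    w∈J = refl
  rot^-*n (suc k) {w} w∈J = trans (rot^-+ n (k ℕ.* n) w) (trans (cong (rot^ n) (rot^-*n k w∈J)) (rot^n w∈J))

  rot^≡⇒n∣ : ∀ {w} → J w → w ≢ 𝟘 → ∀ e → rot^ e w ≡ w → n ∣ e
  rot^≡⇒n∣ {w} w∈J w≢0 e rot^ew≡w =
    X^≡ₕ1⇒n∣ e (h∣X^−1⇒X^≡ₕ1 {e} (h∣annihilator w∈J w≢0 (X^ e − 1#) annihilated))
    where
    annihilated : act rot (X^ e − 1#) w ≡ 𝟘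
    annihilated = begin
      act rot (X^ e − 1#) w    ≡⟨ act-rot-X^− e 1# w ⟩
      rot^ e w ⊕ (- 1#) · w    ≡⟨ cong (_⊕ (- 1#) · w) (trans rot^ew≡w (sym (·-identityˡ w))) ⟩
      1# · w ⊕ (- 1#) · w      ≡⟨ ·-inverseʳ 1# w ⟩
      𝟘                        ∎

  -- An eigenvector of rot^t found inside J hands its eigenvalue on to z, since all nonzero elements of J have the same annihilator (h).
  rot^-eigenvalue : ∀ {z} → J z → z ≢ 𝟘 → 1 ≤ q ∸ 1 → ∀ t → n ∣ (q ∸ 1) ℕ.* t →
                    Σ Carrier λ β → β ≢ 0# × rot^ t z ≡ β · z
  rot^-eigenvalue {z} z∈J z≢0 1≤N t (divides k Nt≡kn) =
    SplitAnnihilator.eigenvector (rot^ t) (rot^-linear t) z z≢0 eigen-transfer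
      βs (X^ N − 1#) (subst (Monic (X^ N − 1#)) (sym (List.length-tabulate enum)) (Monic-X^− 1≤N 1#))
      (All.tabulate⁺ (λ i → trans (eval-X^− N 1# (enum i))
                                 (trans (cong (_+ - 1#) (fermat (enum i) (enum-≢ i))) (-‿inverseʳ 1#))))
      (Unique.tabulate⁺ enum-injective) (All.tabulate⁺ enum-≢) annihilated
    where
    N = q ∸ 1
    open Punctured (↔Fin-suc 0# card) 0#
    module Rot^t = Action (rot^ {n} t) (rot^-linear t)
    βs : List Carrier
    βs = List.tabulate enum

    eigen-transfer : ∀ p β → act (rot^ t) p z ≢ 𝟘 →
                     rot^ t (act (rot^ t) p z) ≡ β · act (rot^ t) p z → rot^ t z ≡ β · z
    eigen-transfer p β w≢0 rot^tw≡βw = annihilated⇒rot^≡ t β z (annihilator-transfer w∈J w≢0 (X^ t − β) killed z∈J)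
      where
      w = act (rot^ t) p z
      w∈J : J w
      w∈J = J-closed (act (rot^ t) p) (Rot^t.act-linear p)
              (λ u → Rot^t.act-commute rot rot-linear (λ v → sym (rot^-rot t v)) p u) z∈J
      killed : act rot (X^ t − β) w ≡ 𝟘
      killed = trans (act-rot-X^− t β w) (trans (cong (_⊕ (- β) · w) rot^tw≡βw) (·-inverseʳ β w))

    annihilated : act (rot^ t) (X^ N − 1#) z ≡ 𝟘
    annihilated = begin
      act (rot^ t) (X^ N − 1#) z         ≡⟨ Rot^t.act-X^− N 1# z ⟩
      iterate (rot^ t) z N ⊕ (- 1#) · z  ≡⟨ cong (_⊕ (- 1#) · z) (iterate-rot^ t z N) ⟩
      rot^ (N ℕ.* t) z ⊕ (- 1#) · z      ≡⟨ cong (λ e → rot^ e z ⊕ (- 1#) · z) Nt≡kn ⟩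
      rot^ (k ℕ.* n) z ⊕ (- 1#) · z      ≡⟨ cong (_⊕ (- 1#) · z) (trans (rot^-*n k z∈J) (sym (·-identityˡ z))) ⟩
      1# · z ⊕ (- 1#) · z                ≡⟨ ·-inverseʳ 1# z ⟩
      𝟘                                  ∎

module OrbitStructure {q : ℕ} (F : FiniteField q) (n m : ℕ) (h : Poly F)
                      (deg-h : Deg F h m) (irr : Irreducible F h) (ord : HasOrder F h n) (1≤N : 1 ≤ q ∸ 1) where
  open MinimalIdeal F n m h deg-h irr ord
  open GcdQuotient (q ∸ 1) n 1≤N (proj₁ ord) using (d; t; d-nonZero; t-nonZero; t*d≡n; n∣N*t; n∣N*e⇒t∣e; n∣δ*t⇒d∣δ)
  open ≡-Reasoning

  Proportional-sym : ∀ {u v : A n} → Proportional F u v → Proportional F v u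
  Proportional-sym {u} {v} (α , α≢0 , u≡αv) = inv α α≢0 , inv-≢0 α α≢0 , (begin
    v                        ≡⟨ sym (·-identityˡ v) ⟩
    1# · v                   ≡⟨ cong (_· v) (sym (*-inverseˡ α α≢0)) ⟩
    (inv α α≢0 * α) · v      ≡⟨ ·-assoc _ α v ⟩
    inv α α≢0 · (α · v)      ≡⟨ cong (inv α α≢0 ·_) (sym u≡αv) ⟩
    inv α α≢0 · u            ∎)

  module _ {z : A n} (z∈J : J z) (z≢0 : z ≢ 𝟘) where

    rot^-power : ∀ e α → rot^ e z ≡ α · z → ∀ k → rot^ (k ℕ.* e) z ≡ α ^ k · z
    rot^-power e α rot^ez≡αz zero    = sym (·-identityˡ z)
    rot^-power e α rot^ez≡αz (suc k) = begin
      rot^ (e ℕ.+ k ℕ.* e) z        ≡⟨ rot^-+ e (k ℕ.* e) z ⟩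
      rot^ e (rot^ (k ℕ.* e) z)     ≡⟨ cong (rot^ e) (rot^-power e α rot^ez≡αz k) ⟩
      rot^ e (α ^ k · z)            ≡⟨ map-· (rot^-linear e) _ z ⟩
      α ^ k · rot^ e z              ≡⟨ cong (α ^ k ·_) rot^ez≡αz ⟩
      α ^ k · (α · z)               ≡⟨ ·-comm _ α z ⟩
      α · (α ^ k · z)               ≡⟨ sym (·-assoc α _ z) ⟩
      (α * α ^ k) · z               ∎

    rot^-+*n : ∀ e k → rot^ (e ℕ.+ k ℕ.* n) z ≡ rot^ e z
    rot^-+*n e k = trans (rot^-+ e (k ℕ.* n) z) (cong (rot^ e) (rot^-*n k z∈J))

    -- The eigenvalue α of a rotation rot^δ z = α z satisfies α^(q-1) = 1, so rot^((q-1)δ) fixes z.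
    rot^≡α·⇒t∣ : ∀ δ α → α ≢ 0# → rot^ δ z ≡ α · z → t ∣ δ
    rot^≡α·⇒t∣ δ α α≢0 rot^δz≡αz = n∣N*e⇒t∣e δ (rot^≡⇒n∣ z∈J z≢0 ((q ∸ 1) ℕ.* δ) (begin
      rot^ ((q ∸ 1) ℕ.* δ) z    ≡⟨ rot^-power δ α rot^δz≡αz (q ∸ 1) ⟩
      α ^ (q ∸ 1) · z           ≡⟨ cong (_· z) (fermat α α≢0) ⟩
      1# · z                    ≡⟨ ·-identityˡ z ⟩
      z                         ∎))

    β : Carrier
    β = proj₁ (rot^-eigenvalue z∈J z≢0 1≤N t n∣N*t)

    β≢0 : β ≢ 0#
    β≢0 = proj₁ (proj₂ (rot^-eigenvalue z∈J z≢0 1≤N t n∣N*t))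

    rot^tz≡βz : rot^ t z ≡ β · z
    rot^tz≡βz = proj₂ (proj₂ (rot^-eigenvalue z∈J z≢0 1≤N t n∣N*t))

    rot^-+*t : ∀ j i → rot^ (j ℕ.+ i ℕ.* t) z ≡ β ^ i · rot^ j z
    rot^-+*t j i = begin
      rot^ (j ℕ.+ i ℕ.* t) z          ≡⟨ cong (λ e → rot^ e z) (ℕₚ.+-comm j (i ℕ.* t)) ⟩
      rot^ (i ℕ.* t ℕ.+ j) z          ≡⟨ rot^-+ (i ℕ.* t) j z ⟩
      rot^ (i ℕ.* t) (rot^ j z)       ≡⟨ rot^-comm (i ℕ.* t) j z ⟩
      rot^ j (rot^ (i ℕ.* t) z)       ≡⟨ cong (rot^ j) (rot^-power t β rot^tz≡βz i) ⟩
      rot^ j (β ^ i · z)              ≡⟨ map-· (rot^-linear j) _ z ⟩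
      β ^ i · rot^ j z                ∎

    Proportional-shift⇒t∣ : ∀ a δ → Proportional F (rot^ a z) (rot^ (a ℕ.+ δ) z) → t ∣ δ
    Proportional-shift⇒t∣ a δ (α , α≢0 , rot^az≡α·) = rot^≡α·⇒t∣ δ _ (proj₁ (proj₂ prop)) (proj₂ (proj₂ prop))
      where
      z≡α·rot^δz : z ≡ α · rot^ δ z
      z≡α·rot^δz = rot^-injective a z _ (begin
        rot^ a z                       ≡⟨ rot^az≡α· ⟩
        α · rot^ (a ℕ.+ δ) z           ≡⟨ cong (α ·_) (rot^-+ a δ z) ⟩
        α · rot^ a (rot^ δ z)          ≡⟨ sym (map-· (rot^-linear a) α _) ⟩
        rot^ a (α · rot^ δ z)          ∎)
      prop : Proportional F (rot^ δ z) z
      prop = Proportional-sym (α , α≢0 , z≡α·rot^δz)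

    cycle-meets-t-classes : CycleMeetsClasses F z t
    cycle-meets-t-classes = toℕ , distinct , covering
      where
      distinct : ∀ (i i′ : Fin t) → Proportional F (rot^ (toℕ i) z) (rot^ (toℕ i′) z) → i ≡ i′
      distinct i i′ = Finₚ.toℕ-injective ∘ ≡-by-shifts (λ a b → Proportional F (rot^ a z) (rot^ b z)) Proportional-sym
        (λ a δ a+δ<t prop → ∣∧<⇒≡0 (Proportional-shift⇒t∣ a δ prop) (ℕₚ.≤-<-trans (ℕₚ.m≤n+m δ a) a+δ<t))
        (Finₚ.toℕ<n i) (Finₚ.toℕ<n i′)
      covering : ∀ j → ∃ λ (i : Fin t) → Proportional F (rot^ j z) (rot^ (toℕ i) z)
      covering j = i , β ^ (j / t) , ^-≢0 (j / t) β≢0 , (begin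
        rot^ j z                          ≡⟨ cong (λ e → rot^ e z) j≡i+[j/t]t ⟩
        rot^ (toℕ i ℕ.+ (j / t) ℕ.* t) z  ≡⟨ rot^-+*t (toℕ i) (j / t) ⟩
        β ^ (j / t) · rot^ (toℕ i) z      ∎)
        where
        i = fromℕ< (m%n<n j t)
        j≡i+[j/t]t : j ≡ toℕ i ℕ.+ (j / t) ℕ.* t
        j≡i+[j/t]t = trans (m≡m%n+[m/n]*n j t) (cong (ℕ._+ (j / t) ℕ.* t) (sym (Finₚ.toℕ-fromℕ< (m%n<n j t))))

    rot^-*t-injective : ∀ {a b} → a < d → b < d → rot^ (a ℕ.* t) z ≡ rot^ (b ℕ.* t) z → a ≡ b
    rot^-*t-injective = ≡-by-shifts (λ a b → rot^ (a ℕ.* t) z ≡ rot^ (b ℕ.* t) z) sym shift≡0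
      where
      shift≡0 : ∀ a δ → a ℕ.+ δ < d → rot^ (a ℕ.* t) z ≡ rot^ ((a ℕ.+ δ) ℕ.* t) z → δ ≡ 0
      shift≡0 a δ a+δ<d eq = ∣∧<⇒≡0 (n∣δ*t⇒d∣δ δ (rot^≡⇒n∣ z∈J z≢0 (δ ℕ.* t) (sym z≡rot^[δt]z)))
                                     (ℕₚ.≤-<-trans (ℕₚ.m≤n+m δ a) a+δ<d)
        where
        z≡rot^[δt]z : z ≡ rot^ (δ ℕ.* t) z
        z≡rot^[δt]z = rot^-injective (a ℕ.* t) z _ (begin
          rot^ (a ℕ.* t) z                  ≡⟨ eq ⟩
          rot^ ((a ℕ.+ δ) ℕ.* t) z          ≡⟨ cong (λ e → rot^ e z) (ℕₚ.*-distribʳ-+ t a δ) ⟩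
          rot^ (a ℕ.* t ℕ.+ δ ℕ.* t) z      ≡⟨ rot^-+ (a ℕ.* t) (δ ℕ.* t) z ⟩
          rot^ (a ℕ.* t) (rot^ (δ ℕ.* t) z) ∎)

    -- Every rotation proportional to rot^j z is rot^(j + s t) z for some s, and s only matters modulo d since d t = n.
    class-meets-cycle-in-d : ∀ j → ClassMeetsCycleIn F z j d
    class-meets-cycle-in-d j = shift , injective , proportional , complete
      where
      shift : Fin d → ℕ
      shift i = j ℕ.+ toℕ i ℕ.* t
      injective : ∀ i i′ → rot^ (shift i) z ≡ rot^ (shift i′) z → i ≡ i′
      injective i i′ eq = Finₚ.toℕ-injective (rot^-*t-injective (Finₚ.toℕ<n i) (Finₚ.toℕ<n i′)
        (rot^-injective j _ _ (trans (sym (rot^-+ j _ z)) (trans eq (rot^-+ j _ z)))))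
      proportional : ∀ i → Proportional F (rot^ (shift i) z) (rot^ j z)
      proportional i = β ^ toℕ i , ^-≢0 (toℕ i) β≢0 , rot^-+*t j (toℕ i)
      complete : ∀ k → Proportional F (rot^ k z) (rot^ j z) → ∃ λ i → rot^ k z ≡ rot^ (shift i) z
      complete k prop = fromℕ< (m%n<n s d) , (begin
        rot^ k z                                    ≡⟨ sym rot^[j+δ]≡rot^k ⟩
        rot^ (j ℕ.+ δ) z                            ≡⟨ cong (λ e → rot^ (j ℕ.+ e) z) (trans δ≡s*t s*t≡) ⟩
        rot^ (j ℕ.+ (toℕ i₀ ℕ.* t ℕ.+ (s / d) ℕ.* n)) z ≡⟨ cong (λ e → rot^ e z) (sym (ℕₚ.+-assoc j _ _)) ⟩
        rot^ (shift i₀ ℕ.+ (s / d) ℕ.* n) z         ≡⟨ rot^-+*n (shift i₀) (s / d) ⟩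
        rot^ (shift i₀) z                           ∎)
        where
        j≤k+jn : j ≤ k ℕ.+ j ℕ.* n
        j≤k+jn = ℕₚ.≤-trans (ℕₚ.m≤m*n j n) (ℕₚ.m≤n+m (j ℕ.* n) k)
        δ = proj₁ (ℕₚ.m≤n⇒∃[o]m+o≡n j≤k+jn)
        j+δ≡ : j ℕ.+ δ ≡ k ℕ.+ j ℕ.* n
        j+δ≡ = proj₂ (ℕₚ.m≤n⇒∃[o]m+o≡n j≤k+jn)
        rot^[j+δ]≡rot^k : rot^ (j ℕ.+ δ) z ≡ rot^ k z
        rot^[j+δ]≡rot^k = trans (cong (λ e → rot^ e z) j+δ≡) (rot^-+*n k j)
        t∣δ : t ∣ δ
        t∣δ = Proportional-shift⇒t∣ j δ (subst (Proportional F (rot^ j z)) (sym rot^[j+δ]≡rot^k) (Proportional-sym prop))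
        s = _∣_.quotient t∣δ
        δ≡s*t : δ ≡ s ℕ.* t
        δ≡s*t = _∣_.equality t∣δ
        i₀ = fromℕ< (m%n<n s d)
        s*t≡ : s ℕ.* t ≡ toℕ i₀ ℕ.* t ℕ.+ (s / d) ℕ.* n
        s*t≡ = begin
          s ℕ.* t                                     ≡⟨ cong (ℕ._* t) (m≡m%n+[m/n]*n s d) ⟩
          (s % d ℕ.+ (s / d) ℕ.* d) ℕ.* t             ≡⟨ ℕₚ.*-distribʳ-+ t (s % d) _ ⟩
          s % d ℕ.* t ℕ.+ (s / d) ℕ.* d ℕ.* t         ≡⟨ cong₂ ℕ._+_ (cong (ℕ._* t) (sym (Finₚ.toℕ-fromℕ< (m%n<n s d))))
                                                          (trans (ℕₚ.*-assoc (s / d) d t) (cong ((s / d) ℕ.*_) (trans (ℕₚ.*-comm d t) t*d≡n))) ⟩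
          toℕ i₀ ℕ.* t ℕ.+ (s / d) ℕ.* n             ∎

open import Data.Nat using (_^_)

theorem2 : (q : ℕ) (F : FiniteField q) (n m : ℕ) (h : List (FiniteField.Carrier F)) →
    IsPrimePower q → 2 < q → 1 ≤ n → Coprime n q →
    Irreducible F h → Deg F h m → 1 < m → HasOrder F h n → n ≢ q ^ m ∸ 1 →
    (∀ (z : Vec (FiniteField.Carrier F) n) → z ≢ zeroA F → InJ F h z →
        CycleMeetsClasses F z (n div gcd (q ∸ 1) n)
        × (∀ j → ClassMeetsCycleIn F z j (gcd (q ∸ 1) n)))
    × (1 ≤ gcd (q ∸ 1) n × gcd (q ∸ 1) n ≤ q ∸ 1)
    × (1 ≤ n div gcd (q ∸ 1) n × n div gcd (q ∸ 1) n ≤ (q ^ m ∸ 1) div (q ∸ 1))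
    × (n div gcd (q ∸ 1) n ∣ (q ^ m ∸ 1) div (q ∸ 1))
theorem2 q F n m h _ 2<q _ _ irr deg-h 1<m ord _ =
  (λ z z≢0 z∈J → subst (CycleMeetsClasses F z) (sym t≡) (cycle-meets-t-classes (InJ⇒J z∈J) z≢0)
               , class-meets-cycle-in-d (InJ⇒J z∈J) z≢0)
  , (1≤d , d≤N)
  , (subst (1 ≤_) (sym t≡) 1≤t , subst₂ _≤_ (sym t≡) (sym R≡) (t≤Q/N Q N∣Q n∣Q N≤Q))
  , subst₂ _∣_ (sym t≡) (sym R≡) (t∣Q/N Q N∣Q n∣Q N≤Q)
  where
  1≤q : 1 ≤ q
  1≤q = ℕₚ.≤-trans (s≤s z≤n) 2<q
  1≤m : 1 ≤ m
  1≤m = ℕₚ.<⇒≤ 1<m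
  1≤N : 1 ≤ q ∸ 1
  1≤N = ℕₚ.∸-monoˡ-≤ 1 (ℕₚ.<⇒≤ 2<q)
  open MinimalIdeal F n m h deg-h irr ord using (InJ⇒J)
  open OrbitStructure F n m h deg-h irr ord 1≤N
  open GcdQuotient (q ∸ 1) n 1≤N (proj₁ ord)
  Q : ℕ
  Q = q ^ m ∸ 1
  N∣Q : q ∸ 1 ∣ Q
  N∣Q = q∸1∣q^m∸1 m 1≤q
  n∣Q : n ∣ Q
  n∣Q = ResidueRing.n∣q^m∸1 F n m h deg-h irr ord 1≤m
  N≤Q : q ∸ 1 ≤ Q
  N≤Q = ℕₚ.∸-monoˡ-≤ 1 (q≤q^m 1≤q 1≤m)
  t≡ : n div gcd (q ∸ 1) n ≡ t
  t≡ = div≡/ n d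
  R≡ : (q ^ m ∸ 1) div (q ∸ 1) ≡ Q / (q ∸ 1)
  R≡ = div≡/ Q (q ∸ 1)
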